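{- $$A^{(2)}(x_1,x_2,x_3,\dots)=1+\frac{x_1^2(1-x_2+x_2A^{(2)}(x_1,x_2x_3,x_3x_4,\dots))}{1-x_1^2x_2(1-x_2x_3+x_2x_3A^{(2)}(x_1,x_2x_3^2x_4,x_3x_4^2x_5,\dots))},$$ and $$B^{(2)}(x_1,x_2,x_3,\dots)=x_1-x_1x_2+x_1x_2A^{(2)}(x_1,x_2x_3,x_3x_4\dots).$$
   Context: A permutation $\pi$ is a Dumont permutation (of the first kind) if each even integer in $\pi$ is followed by a smaller integer, and each odd integer is either followed by a larger integer or is the last element of $\pi$. Let $\mathcal{D}$ be the set of Dumont permutations of all sizes (including the empty one) avoiding $1\mbox{ - }3\mbox{ - }2$. Generalized patterns: letters separated by dashes may be at any distance, adjacent letters (as $12$ in $12\mbox{ - }3\mbox{ - }\cdots\mbox{ - }j$) must be adjacent in $\pi$. For a pattern $\tau$, $\tau(\pi)$ is its number of occurrences in $\pi$; $1(\pi)$ is the length of $\pi$. Define $\mathcal{B}(x_1,x_2,\dots)=\sum_{\pi\in\mathcal{D}}x_1^{1(\pi)}\prod_{j\geq2}x_j^{12\mbox{ - }3\mbox{ - }\dots\mbox{ - } j(\pi)}$, $A^{(2)}(x_1,x_2,\dots)=\frac12(\mathcal{B}(x_1,x_2,\dots)+\mathcal{B}(-x_1,x_2,\dots))$, $B^{(2)}(x_1,x_2,\dots)=\frac12(\mathcal{B}(x_1,x_2,\dots)-\mathcal{B}(-x_1,x_2,\dots))$. -}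

module Defs where

open import Data.Bool using (Bool; true; false; _∧_; _∨_; not; if_then_else_)
open import Data.Nat using (ℕ; zero; suc; _+_; _*_; _∸_; _<ᵇ_; _≡ᵇ_)
open import Data.Integer using (ℤ; +_; -_) renaming (_+_ to _+ℤ_; _*_ to _*ℤ_)
open import Data.List using (List; []; _∷_; _++_; map; concatMap; filter; foldr; upTo; length; zipWith; head)
open import Data.Maybe using (fromMaybe)
open import Data.Product using (_×_; _,_)
open import Relation.Binary.PropositionalEquality using (_≡_)
open import Relation.Nullary.Decidable using (Dec)
open import Data.Bool.Properties using () renaming (_≟_ to _≟B_)

even : ℕ → Bool
even zero          = true
even (suc zero)    = false
even (suc (suc n)) = even n

odd : ℕ → Bool
odd n = not (even n)

insertions : ℕ → List ℕ → List (List ℕ)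
insertions x []       = (x ∷ []) ∷ []
insertions x (y ∷ ys) = (x ∷ y ∷ ys) ∷ map (y ∷_) (insertions x ys)

perms : ℕ → List (List ℕ)
perms zero    = [] ∷ []
perms (suc n) = concatMap (insertions (suc n)) (perms n)

-- Dumont permutation of the first kind: every even entry is followed by a
-- smaller entry; every odd entry is followed by a larger one or is last.
isDumont : List ℕ → Bool
isDumont []            = true
isDumont (a ∷ [])      = odd a
isDumont (a ∷ b ∷ r)   = (if even a then b <ᵇ a else a <ᵇ b) ∧ isDumont (b ∷ r)

has32above : ℕ → List ℕ → Bool
has32above a []       = false
has32above a (y ∷ ys) = foldr (λ z acc → ((a <ᵇ z) ∧ (z <ᵇ y)) ∨ acc) false ys ∨ has32above a ys

contains132 : List ℕ → Bool
contains132 []       = false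
contains132 (a ∷ as) = has32above a as ∨ contains132 as

incAbove : ℕ → ℕ → List ℕ → ℕ
incAbove zero    b l        = 1
incAbove (suc k) b []       = 0
incAbove (suc k) b (x ∷ xs) = (if b <ᵇ x then incAbove k x xs else 0) + incAbove (suc k) b xs

-- occ k π = number of occurrences of the generalized pattern 12-3-…-j in π,
-- where j = k + 2  (positions i1<i2<…<ij, i2 = i1+1, values increasing).
occ : ℕ → List ℕ → ℕ
occ k []          = 0
occ k (a ∷ [])    = 0
occ k (a ∷ b ∷ r) = (if a <ᵇ b then incAbove k b r else 0) + occ k (b ∷ r)

-- A monomial is a list of exponents [e₂, e₃, e₄, …] (x₂^e₂ x₃^e₃ …);
-- missing trailing entries are exponent 0.
Mono : Set
Mono = List ℕ

eqMono : Mono → Mono → Bool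
eqMono []       []       = true
eqMono []       (y ∷ ys) = (y ≡ᵇ 0) ∧ eqMono [] ys
eqMono (x ∷ xs) []       = (x ≡ᵇ 0) ∧ eqMono xs []
eqMono (x ∷ xs) (y ∷ ys) = (x ≡ᵇ y) ∧ eqMono xs ys

mulMono : Mono → Mono → Mono
mulMono []       ys       = ys
mulMono (x ∷ xs) []       = x ∷ xs
mulMono (x ∷ xs) (y ∷ ys) = (x + y) ∷ mulMono xs ys

-- A polynomial is a formal ℤ-linear combination of monomials (unnormalised)
Poly : Set
Poly = List (ℤ × Mono)

coeff : Poly → Mono → ℤ
coeff []             m = + 0
coeff ((c , m') ∷ p) m = (if eqMono m' m then c else + 0) +ℤ coeff p m

_≈P_ : Poly → Poly → Set
p ≈P q = ∀ m → coeff p m ≡ coeff q m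

addP : Poly → Poly → Poly
addP p q = p ++ q

negP : Poly → Poly
negP = map (λ { (c , m) → (- c , m) })

mulP : Poly → Poly → Poly
mulP p q = concatMap (λ { (c , m) → map (λ { (d , n) → (c *ℤ d , mulMono m n) }) q }) p

sumP : List Poly → Poly
sumP = foldr addP []

oneP : Poly
oneP = (+ 1 , []) ∷ []

var : ℕ → Poly
var j = (+ 1 , expo (j ∸ 2)) ∷ []
  where
  expo : ℕ → Mono
  expo zero    = 1 ∷ []
  expo (suc i) = 0 ∷ expo i

-- Substitutions on the variables x₂, x₃, … (ring homomorphisms, given on monomials)
-- σ₁ : x_j ↦ x_j x_{j+1}            (j ≥ 2)
-- σ₂ : x_j ↦ x_j x_{j+1}² x_{j+2}   (j ≥ 2)
scaleMono : ℕ → Mono → Mono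
scaleMono k = map (k *_)

σ₁Mono : Mono → Mono
σ₁Mono e = mulMono e (0 ∷ e)

σ₂Mono : Mono → Mono
σ₂Mono e = mulMono e (mulMono (0 ∷ scaleMono 2 e) (0 ∷ 0 ∷ e))

substP : (Mono → Mono) → Poly → Poly
substP f = map (λ { (c , m) → (c , f m) })

-- Formal power series in x₁ with coefficients in ℤ[x₂, x₃, …]
-- (S n is the coefficient of x₁ⁿ)

Series : Set
Series = ℕ → Poly

infixl 6 _⊕_
infixl 7 _⊛_ _⊘_
infix 8 ⊖_
infix 4 _≈S_ _≈P_

_≈S_ : Series → Series → Set
S ≈S T = ∀ n → S n ≈P T n

constS : Poly → Series
constS p zero    = p
constS p (suc n) = []

_⊕_ : Series → Series → Series
(S ⊕ T) n = addP (S n) (T n)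

⊖_ : Series → Series
(⊖ S) n = negP (S n)

_⊛_ : Series → Series → Series
(S ⊛ T) n = sumP (map (λ k → mulP (S k) (T (n ∸ k))) (upTo (suc n)))

x₁¹· : Series → Series
x₁¹· S zero    = []
x₁¹· S (suc n) = S n

x₁²· : Series → Series
x₁²· S zero          = []
x₁²· S (suc zero)    = []
x₁²· S (suc (suc n)) = S n

substS : (Mono → Mono) → Series → Series
substS f S n = substP f (S n)

-- Division N / D of power series, for D with constant term 1:
-- the unique Q with Q ⊛ D = N, i.e. Q n = N n − Σ_{k=1}^{n} D k · Q (n−k).
-- revQs n = Q n ∷ Q (n−1) ∷ … ∷ Q 0
revQs : Series → Series → ℕ → List Poly
revQs N D zero    = N zero ∷ []
revQs N D (suc n) =
  addP (N (suc n))
       (negP (sumP (zipWith mulP (map (λ k → D (suc k)) (upTo (suc n))) (revQs N D n))))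
  ∷ revQs N D n

_⊘_ : Series → Series → Series
(N ⊘ D) n = fromMaybe [] (head (revQs N D n))

dumont132 : ℕ → List (List ℕ)
dumont132 n = filter (λ π → isDumont π ≟B true) (filter (λ π → contains132 π ≟B false) (perms n))

-- the monomial ∏_{j≥2} x_j^{12-3-…-j(π)}  (j runs over 2…|π|+1; larger j give 0)
monoOf : List ℕ → Mono
monoOf π = map (λ k → occ k π) (upTo (length π))

𝓑 : Series
𝓑 n = map (λ π → (+ 1 , monoOf π)) (dumont132 n)

-- A⁽²⁾ = ½(𝓑(x₁,…) + 𝓑(−x₁,…)) : the even-in-x₁ part of 𝓑
A2 : Series
A2 n = if even n then 𝓑 n else []

-- B⁽²⁾ = ½(𝓑(x₁,…) − 𝓑(−x₁,…)) : the odd-in-x₁ part of 𝓑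
B2 : Series
B2 n = if even n then [] else 𝓑 n

-- A 132-avoiding Dumont permutation of odd length m + 1 ends with its maximum, and
-- appending the maximum to a nonempty ρ multiplies its weight by x₂ σ₁; this gives
-- B⁽²⁾ = x₁ (1 − x₂ + x₂ σ₁ A⁽²⁾). One of even length n + 1 either starts with n + 1 or
-- is shift (n − k) (τ ++ [k]) ++ (n + 1) ∷ β with k odd, |τ| = k − 1 and |β| = n − k:
-- avoiding 1-3-2 puts every entry before n + 1 above every entry after it, and the
-- Dumont condition forces the odd entry n to sit just before n + 1 and k to be odd.
-- The word τ k (k + 1) has weight x₂ for k = 1 and x₂ · x₂x₃ · σ₂(τ) otherwise, so the
-- coefficients of A⁽²⁾ − 1 satisfy the recurrence that determines the quotient
-- x₁² U / (1 − x₁² x₂ H).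

module Submission where

open import Defs
open import Data.Bool using (Bool; true; false; _∧_; _∨_; not; if_then_else_; T)
import Data.Bool.Properties as BoolP
open import Data.Nat using (ℕ; zero; suc; _+_; _*_; _∸_; _≤_; _<_; z≤n; s≤s; _<ᵇ_; _≡ᵇ_; _≤ᵇ_; _≤?_)
import Data.Nat.Properties as ℕP
open import Algebra.Properties.CommutativeSemigroup ℕP.+-commutativeSemigroup
  using () renaming (interchange to +-interchange)
open import Data.Integer using (ℤ; -_; 0ℤ; 1ℤ) renaming (_+_ to _+ℤ_; _*_ to _*ℤ_)
import Data.Integer.Properties as ℤP
open import Data.List using (List; []; _∷_; _++_; map; concatMap; filter; foldr; upTo; length; zipWith; applyUpTo)
open import Data.List.Properties
  using (∷-injective; ∷-injectiveʳ; ++-assoc; length-++; map-++; ++-identityʳ; ∷ʳ-injectiveˡ; ++-cancelˡ;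
         map-injective; length-map; map-applyUpTo; upTo-∷ʳ)
open import Data.List.Membership.Propositional using (_∈_; _∉_; find; lose)
open import Data.List.Membership.Propositional.Properties
  using (∈-++⁺ˡ; ∈-++⁺ʳ; ∈-++⁻; ∈-map⁺; ∈-map⁻; ∈-∃++; ∈-concatMap⁺; ∈-concatMap⁻; ∈-filter⁺; ∈-filter⁻;
         ∈-upTo⁺; ∈-upTo⁻; ∈-insert)
open import Data.List.Membership.Propositional.Properties.WithK using (unique∧set⇒bag)
open import Data.List.Relation.Unary.Any using (here; there)
open import Data.List.Relation.Unary.All using (All; []; _∷_)
open import Data.List.Relation.Unary.AllPairs using ([]; _∷_)
open import Data.List.Relation.Unary.Unique.Propositional using (Unique)
import Data.List.Relation.Unary.Unique.Propositional.Properties as Unique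
open import Data.List.Relation.Binary.BagAndSetEquality using (∼bag⇒↭)
open import Data.List.Relation.Binary.Permutation.Propositional using (_↭_; ↭-sym; ↭⇒↭ₛ)
import Data.List.Relation.Binary.Permutation.Propositional.Properties as ↭
import Data.List.Relation.Binary.Permutation.Setoid.Properties as ↭ₛ
open import Data.Product using (_×_; _,_; proj₁; proj₂; ∃; ∃₂)
open import Data.Sum using (_⊎_; inj₁; inj₂)
open import Data.Empty using (⊥; ⊥-elim)
open import Function.Bundles using (mk⇔)
open import Data.Nat.Solver using (module +-*-Solver)
open import Relation.Nullary using (¬_; Dec; yes; no)
open import Relation.Binary.PropositionalEquality
open ≡-Reasoning
open +-*-Solver using (solve; _:=_; _:+_; _:*_; con)

∧-true⁻ : ∀ {a b} → (a ∧ b) ≡ true → a ≡ true × b ≡ true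
∧-true⁻ {true} {true} _ = refl , refl

∧-true⁺ : ∀ {a b} → a ≡ true → b ≡ true → (a ∧ b) ≡ true
∧-true⁺ refl refl = refl

∨-false⁻ : ∀ {a b} → (a ∨ b) ≡ false → a ≡ false × b ≡ false
∨-false⁻ {false} {false} _ = refl , refl

∨-false⁺ : ∀ {a b} → a ≡ false → b ≡ false → (a ∨ b) ≡ false
∨-false⁺ refl refl = refl

∨-trueˡ : ∀ {a} b → a ≡ true → (a ∨ b) ≡ true
∨-trueˡ b refl = refl

∨-trueʳ : ∀ a {b} → b ≡ true → (a ∨ b) ≡ true
∨-trueʳ true  _ = refl
∨-trueʳ false p = p

bool-ext : ∀ {a b} → (a ≡ true → b ≡ true) → (b ≡ true → a ≡ true) → a ≡ b
bool-ext {true}  {true}  _ _ = refl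
bool-ext {false} {false} _ _ = refl
bool-ext {true}  {false} f _ = sym (f refl)
bool-ext {false} {true}  _ g = g refl

true≢false : true ≢ false
true≢false ()

≡ᵇ⇒≡ : ∀ {m n} → (m ≡ᵇ n) ≡ true → m ≡ n
≡ᵇ⇒≡ {m} {n} p = ℕP.≡ᵇ⇒≡ m n (subst T (sym p) _)

≡⇒≡ᵇ : ∀ {m n} → m ≡ n → (m ≡ᵇ n) ≡ true
≡⇒≡ᵇ {m} {n} p with m ≡ᵇ n | ℕP.≡⇒≡ᵇ m n p
... | true | _ = refl

<⇒<ᵇ : ∀ {m n} → m < n → (m <ᵇ n) ≡ true
<⇒<ᵇ {zero}  {suc n} _         = refl
<⇒<ᵇ {suc m} {suc n} (s≤s m<n) = <⇒<ᵇ m<n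

≥⇒≮ᵇ : ∀ {m n} → n ≤ m → (m <ᵇ n) ≡ false
≥⇒≮ᵇ {m}     {zero}  _         = refl
≥⇒≮ᵇ {suc m} {suc n} (s≤s n≤m) = ≥⇒≮ᵇ n≤m

<ᵇ⇒< : ∀ {m n} → (m <ᵇ n) ≡ true → m < n
<ᵇ⇒< {m} {n} p = ℕP.<ᵇ⇒< m n (subst T (sym p) _)

≤ᵇ⇒≤ : ∀ {m n} → (m ≤ᵇ n) ≡ true → m ≤ n
≤ᵇ⇒≤ {m} {n} p = ℕP.≤ᵇ⇒≤ m n (subst T (sym p) _)

≤⇒≤ᵇ : ∀ {m n} → m ≤ n → (m ≤ᵇ n) ≡ true
≤⇒≤ᵇ {m} {n} p with m ≤ᵇ n | ℕP.≤⇒≤ᵇ p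
... | true | _ = refl

+-<ᵇ-+ : ∀ c a b → (c + a <ᵇ c + b) ≡ (a <ᵇ b)
+-<ᵇ-+ zero    a b = refl
+-<ᵇ-+ (suc c) a b = +-<ᵇ-+ c a b

even-suc : ∀ m → even (suc m) ≡ not (even m)
even-suc zero          = refl
even-suc (suc zero)    = refl
even-suc (suc (suc m)) = even-suc m

even-suc-flip : ∀ m {b} → even m ≡ b → even (suc m) ≡ not b
even-suc-flip m m-parity = trans (even-suc m) (cong not m-parity)

even-pred-flip : ∀ m {b} → even (suc m) ≡ b → even m ≡ not b
even-pred-flip m sucm-parity = trans (sym (BoolP.not-involutive (even m))) (cong not (trans (sym (even-suc m)) sucm-parity))

even-+ : ∀ c a → even c ≡ true → even (c + a) ≡ even a
even-+ zero          a _ = refl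
even-+ (suc (suc c)) a p = even-+ c a p

even-∸ : ∀ n k → k ≤ n → even (n ∸ k) ≡ (if even k then even n else not (even n))
even-∸ n       zero    z≤n       = refl
even-∸ (suc n) (suc k) (s≤s k≤n) = begin
  even (n ∸ k)                                       ≡⟨ even-∸ n k k≤n ⟩
  (if even k then even n else not (even n))          ≡⟨ flip (even k) (even n) ⟩
  (if not (even k) then not (even n) else not (not (even n)))
    ≡⟨ cong₂ (λ u v → if u then v else not v) (sym (even-suc k)) (sym (even-suc n)) ⟩
  (if even (suc k) then even (suc n) else not (even (suc n))) ∎
  where
  flip : ∀ a b → (if a then b else not b) ≡ (if not a then not b else not (not b))
  flip true  b = sym (BoolP.not-involutive b)
  flip false b = refl

odd⇒≥1 : ∀ {k} → even k ≡ false → 1 ≤ k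
odd⇒≥1 {suc k} _ = s≤s z≤n

odd∸odd-even : ∀ n k → k ≤ n → even n ≡ false → even k ≡ false → even (n ∸ k) ≡ true
odd∸odd-even n k k≤n n-odd k-odd = begin
  even (n ∸ k)                               ≡⟨ even-∸ n k k≤n ⟩
  (if even k then even n else not (even n)) ≡⟨ cong (λ b → if b then even n else not (even n)) k-odd ⟩
  not (even n)                               ≡⟨ cong not n-odd ⟩
  true                                       ∎

even∸odd-odd : ∀ n k → k ≤ n → even n ≡ true → even k ≡ false → even (n ∸ k) ≡ false
even∸odd-odd n k k≤n n-even k-odd = begin
  even (n ∸ k)                               ≡⟨ even-∸ n k k≤n ⟩
  (if even k then even n else not (even n)) ≡⟨ cong (λ b → if b then even n else not (even n)) k-odd ⟩
  not (even n)                               ≡⟨ cong not n-even ⟩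
  false                                      ∎

exponent : Mono → ℕ → ℕ
exponent []       i       = 0
exponent (x ∷ xs) zero    = x
exponent (x ∷ xs) (suc i) = exponent xs i

infix 4 _≋_
_≋_ : Mono → Mono → Set
a ≋ b = ∀ i → exponent a i ≡ exponent b i

eqMono-sound : ∀ a b → eqMono a b ≡ true → a ≋ b
eqMono-sound []       []       p i       = refl
eqMono-sound []       (y ∷ ys) p zero    = sym (≡ᵇ⇒≡ (proj₁ (∧-true⁻ p)))
eqMono-sound []       (y ∷ ys) p (suc i) = eqMono-sound [] ys (proj₂ (∧-true⁻ {y ≡ᵇ 0} p)) i
eqMono-sound (x ∷ xs) []       p zero    = ≡ᵇ⇒≡ (proj₁ (∧-true⁻ p))
eqMono-sound (x ∷ xs) []       p (suc i) = eqMono-sound xs [] (proj₂ (∧-true⁻ {x ≡ᵇ 0} p)) i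
eqMono-sound (x ∷ xs) (y ∷ ys) p zero    = ≡ᵇ⇒≡ (proj₁ (∧-true⁻ p))
eqMono-sound (x ∷ xs) (y ∷ ys) p (suc i) = eqMono-sound xs ys (proj₂ (∧-true⁻ {x ≡ᵇ y} p)) i

eqMono-complete : ∀ a b → a ≋ b → eqMono a b ≡ true
eqMono-complete []       []       p = refl
eqMono-complete []       (y ∷ ys) p = ∧-true⁺ (≡⇒≡ᵇ (sym (p zero))) (eqMono-complete [] ys (λ i → p (suc i)))
eqMono-complete (x ∷ xs) []       p = ∧-true⁺ (≡⇒≡ᵇ (p zero)) (eqMono-complete xs [] (λ i → p (suc i)))
eqMono-complete (x ∷ xs) (y ∷ ys) p = ∧-true⁺ (≡⇒≡ᵇ (p zero)) (eqMono-complete xs ys (λ i → p (suc i)))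

eqMono-congˡ : ∀ {a b} e → a ≋ b → eqMono a e ≡ eqMono b e
eqMono-congˡ {a} {b} e a≋b = bool-ext
  (λ p → eqMono-complete b e (λ i → trans (sym (a≋b i)) (eqMono-sound a e p i)))
  (λ p → eqMono-complete a e (λ i → trans (a≋b i) (eqMono-sound b e p i)))

exponent-mulMono : ∀ a b i → exponent (mulMono a b) i ≡ exponent a i + exponent b i
exponent-mulMono []       b        i       = refl
exponent-mulMono (x ∷ xs) []       i       = sym (ℕP.+-identityʳ _)
exponent-mulMono (x ∷ xs) (y ∷ ys) zero    = refl
exponent-mulMono (x ∷ xs) (y ∷ ys) (suc i) = exponent-mulMono xs ys i

exponent-scaleMono : ∀ k a i → exponent (scaleMono k a) i ≡ k * exponent a i
exponent-scaleMono k []       i       = sym (ℕP.*-zeroʳ k)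
exponent-scaleMono k (x ∷ xs) zero    = refl
exponent-scaleMono k (x ∷ xs) (suc i) = exponent-scaleMono k xs i

exponent-σ₂Mono : ∀ a i →
  exponent (σ₂Mono a) i ≡ exponent a i + (2 * exponent (0 ∷ a) i + exponent (0 ∷ 0 ∷ a) i)
exponent-σ₂Mono a i = begin
  exponent (σ₂Mono a) i
    ≡⟨ exponent-mulMono a _ i ⟩
  exponent a i + exponent (mulMono (scaleMono 2 (0 ∷ a)) (0 ∷ 0 ∷ a)) i
    ≡⟨ cong (exponent a i +_) (exponent-mulMono (scaleMono 2 (0 ∷ a)) (0 ∷ 0 ∷ a) i) ⟩
  exponent a i + (exponent (scaleMono 2 (0 ∷ a)) i + exponent (0 ∷ 0 ∷ a) i)
    ≡⟨ cong (λ z → exponent a i + (z + exponent (0 ∷ 0 ∷ a) i)) (exponent-scaleMono 2 (0 ∷ a) i) ⟩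
  exponent a i + (2 * exponent (0 ∷ a) i + exponent (0 ∷ 0 ∷ a) i) ∎

dividesMono : Mono → Mono → Bool
dividesMono []       e        = true
dividesMono (x ∷ xs) []       = (x ≡ᵇ 0) ∧ dividesMono xs []
dividesMono (x ∷ xs) (y ∷ ys) = (x ≤ᵇ y) ∧ dividesMono xs ys

quotMono : Mono → Mono → Mono
quotMono e        []       = e
quotMono []       (x ∷ xs) = []
quotMono (y ∷ ys) (x ∷ xs) = (y ∸ x) ∷ quotMono ys xs

dividesMono-sound : ∀ a e → dividesMono a e ≡ true → ∀ i → exponent a i ≤ exponent e i
dividesMono-sound []       e        p i       = z≤n
dividesMono-sound (x ∷ xs) []       p zero    = ℕP.≤-reflexive (≡ᵇ⇒≡ (proj₁ (∧-true⁻ p)))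
dividesMono-sound (x ∷ xs) []       p (suc i) = dividesMono-sound xs [] (proj₂ (∧-true⁻ {x ≡ᵇ 0} p)) i
dividesMono-sound (x ∷ xs) (y ∷ ys) p zero    = ≤ᵇ⇒≤ (proj₁ (∧-true⁻ p))
dividesMono-sound (x ∷ xs) (y ∷ ys) p (suc i) = dividesMono-sound xs ys (proj₂ (∧-true⁻ {x ≤ᵇ y} p)) i

dividesMono-complete : ∀ a e → (∀ i → exponent a i ≤ exponent e i) → dividesMono a e ≡ true
dividesMono-complete []       e        p = refl
dividesMono-complete (x ∷ xs) []       p =
  ∧-true⁺ (≡⇒≡ᵇ (ℕP.n≤0⇒n≡0 (p zero))) (dividesMono-complete xs [] (λ i → p (suc i)))
dividesMono-complete (x ∷ xs) (y ∷ ys) p =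
  ∧-true⁺ (≤⇒≤ᵇ (p zero)) (dividesMono-complete xs ys (λ i → p (suc i)))

exponent-quotMono : ∀ e a i → exponent (quotMono e a) i ≡ exponent e i ∸ exponent a i
exponent-quotMono e        []       i       = refl
exponent-quotMono []       (x ∷ xs) zero    = sym (ℕP.0∸n≡0 x)
exponent-quotMono []       (x ∷ xs) (suc i) = sym (ℕP.0∸n≡0 (exponent xs i))
exponent-quotMono (y ∷ ys) (x ∷ xs) zero    = refl
exponent-quotMono (y ∷ ys) (x ∷ xs) (suc i) = exponent-quotMono ys xs i

eqMono-mulMono : ∀ a b e → eqMono (mulMono a b) e ≡ (dividesMono a e ∧ eqMono b (quotMono e a))
eqMono-mulMono a b e = bool-ext to from
  where
  to : eqMono (mulMono a b) e ≡ true → (dividesMono a e ∧ eqMono b (quotMono e a)) ≡ true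
  to p = ∧-true⁺ (dividesMono-complete a e a≤e) (eqMono-complete b (quotMono e a) b≋e/a)
    where
    ab≋e : ∀ i → exponent a i + exponent b i ≡ exponent e i
    ab≋e i = trans (sym (exponent-mulMono a b i)) (eqMono-sound (mulMono a b) e p i)
    a≤e : ∀ i → exponent a i ≤ exponent e i
    a≤e i = subst (exponent a i ≤_) (ab≋e i) (ℕP.m≤m+n _ _)
    b≋e/a : b ≋ quotMono e a
    b≋e/a i = begin
      exponent b i                                ≡⟨ sym (ℕP.m+n∸m≡n (exponent a i) (exponent b i)) ⟩
      exponent a i + exponent b i ∸ exponent a i  ≡⟨ cong (_∸ exponent a i) (ab≋e i) ⟩
      exponent e i ∸ exponent a i                 ≡⟨ sym (exponent-quotMono e a i) ⟩
      exponent (quotMono e a) i                   ∎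
  from : (dividesMono a e ∧ eqMono b (quotMono e a)) ≡ true → eqMono (mulMono a b) e ≡ true
  from p = eqMono-complete (mulMono a b) e λ i → begin
    exponent (mulMono a b) i                  ≡⟨ exponent-mulMono a b i ⟩
    exponent a i + exponent b i               ≡⟨ cong (exponent a i +_) (eqMono-sound b (quotMono e a) b≋e/a i) ⟩
    exponent a i + exponent (quotMono e a) i  ≡⟨ cong (exponent a i +_) (exponent-quotMono e a i) ⟩
    exponent a i + (exponent e i ∸ exponent a i) ≡⟨ ℕP.m+[n∸m]≡n (dividesMono-sound a e a|e i) ⟩
    exponent e i                              ∎
    where
    a|e = proj₁ (∧-true⁻ p)
    b≋e/a = proj₂ (∧-true⁻ {dividesMono a e} p)

sumBy : {A : Set} → (A → ℤ) → List A → ℤ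
sumBy f xs = foldr _+ℤ_ 0ℤ (map f xs)

module _ {A : Set} where

  sumBy-++ : ∀ (f : A → ℤ) xs ys → sumBy f (xs ++ ys) ≡ sumBy f xs +ℤ sumBy f ys
  sumBy-++ f []       ys = sym (ℤP.+-identityˡ _)
  sumBy-++ f (x ∷ xs) ys = trans (cong (f x +ℤ_) (sumBy-++ f xs ys)) (sym (ℤP.+-assoc (f x) _ _))

  sumBy-cong : ∀ {f g : A → ℤ} → (∀ x → f x ≡ g x) → ∀ xs → sumBy f xs ≡ sumBy g xs
  sumBy-cong f≗g []       = refl
  sumBy-cong f≗g (x ∷ xs) = cong₂ _+ℤ_ (f≗g x) (sumBy-cong f≗g xs)

  sumBy-cong∈ : ∀ {f g : A → ℤ} xs → (∀ x → x ∈ xs → f x ≡ g x) → sumBy f xs ≡ sumBy g xs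
  sumBy-cong∈ []       f≗g = refl
  sumBy-cong∈ (x ∷ xs) f≗g = cong₂ _+ℤ_ (f≗g x (here refl)) (sumBy-cong∈ xs (λ y y∈ → f≗g y (there y∈)))

  sumBy-zero : ∀ {f : A → ℤ} → (∀ x → f x ≡ 0ℤ) → ∀ xs → sumBy f xs ≡ 0ℤ
  sumBy-zero f≗0 []       = refl
  sumBy-zero f≗0 (x ∷ xs) = cong₂ _+ℤ_ (f≗0 x) (sumBy-zero f≗0 xs)

  sumBy-neg : ∀ (f : A → ℤ) xs → sumBy (λ x → - f x) xs ≡ - sumBy f xs
  sumBy-neg f []       = refl
  sumBy-neg f (x ∷ xs) = trans (cong (- f x +ℤ_) (sumBy-neg f xs)) (sym (ℤP.neg-distrib-+ (f x) _))

  sumBy-*ˡ : ∀ c (f : A → ℤ) xs → sumBy (λ x → c *ℤ f x) xs ≡ c *ℤ sumBy f xs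
  sumBy-*ˡ c f []       = sym (ℤP.*-zeroʳ c)
  sumBy-*ˡ c f (x ∷ xs) = trans (cong (c *ℤ f x +ℤ_) (sumBy-*ˡ c f xs)) (sym (ℤP.*-distribˡ-+ c (f x) _))

  sumBy-↭ : ∀ (f : A → ℤ) {xs ys} → xs ↭ ys → sumBy f xs ≡ sumBy f ys
  sumBy-↭ f p = ↭ₛ.foldr-commMonoid (setoid ℤ) ℤP.+-0-isCommutativeMonoid (↭⇒↭ₛ (↭.map⁺ f p))

  sumBy-sameElements : ∀ (f : A → ℤ) {xs ys} → Unique xs → Unique ys →
                       (∀ {z} → z ∈ xs → z ∈ ys) → (∀ {z} → z ∈ ys → z ∈ xs) →
                       sumBy f xs ≡ sumBy f ys
  sumBy-sameElements f xs! ys! to from =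
    sumBy-↭ f (∼bag⇒↭ (unique∧set⇒bag xs! ys! (mk⇔ to from)))

module _ {A B : Set} where

  sumBy-map : ∀ (f : B → ℤ) (g : A → B) xs → sumBy f (map g xs) ≡ sumBy (λ x → f (g x)) xs
  sumBy-map f g []       = refl
  sumBy-map f g (x ∷ xs) = cong (f (g x) +ℤ_) (sumBy-map f g xs)

  sumBy-concatMap : ∀ (f : B → ℤ) (g : A → List B) xs →
                    sumBy f (concatMap g xs) ≡ sumBy (λ x → sumBy f (g x)) xs
  sumBy-concatMap f g []       = refl
  sumBy-concatMap f g (x ∷ xs) =
    trans (sumBy-++ f (g x) (concatMap g xs)) (cong (sumBy f (g x) +ℤ_) (sumBy-concatMap f g xs))

sumBy-upTo-suc : ∀ n (h : ℕ → ℤ) → sumBy h (upTo (suc n)) ≡ sumBy h (upTo n) +ℤ h n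
sumBy-upTo-suc n h = begin
  sumBy h (upTo (suc n))              ≡⟨ cong (sumBy h) (sym (upTo-∷ʳ n)) ⟩
  sumBy h (upTo n ++ n ∷ [])          ≡⟨ sumBy-++ h (upTo n) (n ∷ []) ⟩
  sumBy h (upTo n) +ℤ (h n +ℤ 0ℤ)     ≡⟨ cong (sumBy h (upTo n) +ℤ_) (ℤP.+-identityʳ (h n)) ⟩
  sumBy h (upTo n) +ℤ h n             ∎

δ : Mono → Mono → ℤ
δ e a = if eqMono a e then 1ℤ else 0ℤ

δ-congʳ : ∀ e a b → a ≋ b → δ e a ≡ δ e b
δ-congʳ e a b a≋b = cong (λ t → if t then 1ℤ else 0ℤ) (eqMono-congˡ {a} {b} e a≋b)

linExt : (Mono → ℤ) → Poly → ℤ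
linExt g = sumBy (λ t → proj₁ t *ℤ g (proj₂ t))

coeff≡linExt-δ : ∀ p e → coeff p e ≡ linExt (δ e) p
coeff≡linExt-δ []             e = refl
coeff≡linExt-δ ((c , a) ∷ p) e = cong₂ _+ℤ_ (if-as-* (eqMono a e)) (coeff≡linExt-δ p e)
  where
  if-as-* : ∀ b → (if b then c else 0ℤ) ≡ c *ℤ (if b then 1ℤ else 0ℤ)
  if-as-* true  = sym (ℤP.*-identityʳ c)
  if-as-* false = sym (ℤP.*-zeroʳ c)

linExt-++ : ∀ g p q → linExt g (p ++ q) ≡ linExt g p +ℤ linExt g q
linExt-++ g = sumBy-++ _

linExt-cong : ∀ {g h} → (∀ a → g a ≡ h a) → ∀ p → linExt g p ≡ linExt h p
linExt-cong g≗h = sumBy-cong (λ t → cong (proj₁ t *ℤ_) (g≗h (proj₂ t)))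

linExt-zero : ∀ {g} → (∀ a → g a ≡ 0ℤ) → ∀ p → linExt g p ≡ 0ℤ
linExt-zero g≗0 = sumBy-zero (λ t → trans (cong (proj₁ t *ℤ_) (g≗0 (proj₂ t))) (ℤP.*-zeroʳ (proj₁ t)))

linExt-negP : ∀ g p → linExt g (negP p) ≡ - linExt g p
linExt-negP g p = begin
  linExt g (negP p)                              ≡⟨ sumBy-map _ _ p ⟩
  sumBy (λ t → - proj₁ t *ℤ g (proj₂ t)) p       ≡⟨ sumBy-cong (λ t → sym (ℤP.neg-distribˡ-* (proj₁ t) _)) p ⟩
  sumBy (λ t → - (proj₁ t *ℤ g (proj₂ t))) p     ≡⟨ sumBy-neg _ p ⟩
  - linExt g p                                   ∎

linExt-substP : ∀ g f p → linExt g (substP f p) ≡ linExt (λ a → g (f a)) p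
linExt-substP g f = sumBy-map _ _

linExt-sumP : ∀ g ps → linExt g (sumP ps) ≡ sumBy (linExt g) ps
linExt-sumP g []       = refl
linExt-sumP g (p ∷ ps) = trans (linExt-++ g p (sumP ps)) (cong (linExt g p +ℤ_) (linExt-sumP g ps))

linExt-unitTerms : ∀ g (w : List ℕ → Mono) πs →
                   linExt g (map (λ π → (1ℤ , w π)) πs) ≡ sumBy (λ π → g (w π)) πs
linExt-unitTerms g w πs = trans (sumBy-map _ _ πs) (sumBy-cong (λ π → ℤP.*-identityˡ (g (w π))) πs)

linExt-mulP-monomial : ∀ g x p → linExt g (mulP ((1ℤ , x) ∷ []) p) ≡ linExt (λ a → g (mulMono x a)) p
linExt-mulP-monomial g x p = begin
  linExt g (mulP ((1ℤ , x) ∷ []) p)     ≡⟨ sumBy-++ _ (map _ p) [] ⟩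
  linExt g (map _ p) +ℤ 0ℤ              ≡⟨ ℤP.+-identityʳ _ ⟩
  linExt g (map _ p)                    ≡⟨ sumBy-map _ _ p ⟩
  sumBy (λ t → (1ℤ *ℤ proj₁ t) *ℤ g (mulMono x (proj₂ t))) p
    ≡⟨ sumBy-cong (λ t → cong (_*ℤ g (mulMono x (proj₂ t))) (ℤP.*-identityˡ (proj₁ t))) p ⟩
  linExt (λ a → g (mulMono x a)) p      ∎

coeff-mulP : ∀ e p q → coeff (mulP p q) e ≡ linExt (λ a → linExt (λ b → δ e (mulMono a b)) q) p
coeff-mulP e p q = begin
  coeff (mulP p q) e                                        ≡⟨ coeff≡linExt-δ (mulP p q) e ⟩
  linExt (δ e) (mulP p q)                                   ≡⟨ sumBy-concatMap _ _ p ⟩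
  sumBy (λ t → linExt (δ e) (map _ q)) p                    ≡⟨ sumBy-cong term p ⟩
  linExt (λ a → linExt (λ b → δ e (mulMono a b)) q) p       ∎
  where
  term : ∀ t → linExt (δ e) (map (λ s → (proj₁ t *ℤ proj₁ s , mulMono (proj₂ t) (proj₂ s))) q)
             ≡ proj₁ t *ℤ linExt (λ b → δ e (mulMono (proj₂ t) b)) q
  term (c , a) = begin
    _                                                        ≡⟨ sumBy-map _ _ q ⟩
    sumBy (λ s → (c *ℤ proj₁ s) *ℤ δ e (mulMono a (proj₂ s))) q
      ≡⟨ sumBy-cong (λ s → ℤP.*-assoc c (proj₁ s) _) q ⟩
    sumBy (λ s → c *ℤ (proj₁ s *ℤ δ e (mulMono a (proj₂ s)))) q ≡⟨ sumBy-*ˡ c _ q ⟩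
    c *ℤ linExt (λ b → δ e (mulMono a b)) q                  ∎

linExt-δ-mulMono : ∀ e a q →
  linExt (λ b → δ e (mulMono a b)) q ≡ (if dividesMono a e then coeff q (quotMono e a) else 0ℤ)
linExt-δ-mulMono e a q with dividesMono a e in a|e
... | true  = trans (linExt-cong (λ b → cong (λ t → if t then 1ℤ else 0ℤ) (δ-arg b)) q)
                    (sym (coeff≡linExt-δ q (quotMono e a)))
  where
  δ-arg : ∀ b → eqMono (mulMono a b) e ≡ eqMono b (quotMono e a)
  δ-arg b = trans (eqMono-mulMono a b e) (cong (_∧ eqMono b (quotMono e a)) a|e)
... | false = linExt-zero (λ b → cong (λ t → if t then 1ℤ else 0ℤ)
                                     (trans (eqMono-mulMono a b e) (cong (_∧ eqMono b (quotMono e a)) a|e))) q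

mulP-congʳ : ∀ p {q r} → q ≈P r → mulP p q ≈P mulP p r
mulP-congʳ p {q} {r} q≈r e = begin
  coeff (mulP p q) e                                         ≡⟨ coeff-mulP e p q ⟩
  linExt (λ a → linExt (λ b → δ e (mulMono a b)) q) p        ≡⟨ linExt-cong same p ⟩
  linExt (λ a → linExt (λ b → δ e (mulMono a b)) r) p        ≡⟨ coeff-mulP e p r ⟨
  coeff (mulP p r) e                                         ∎
  where
  same : ∀ a → linExt (λ b → δ e (mulMono a b)) q ≡ linExt (λ b → δ e (mulMono a b)) r
  same a = begin
    linExt (λ b → δ e (mulMono a b)) q                       ≡⟨ linExt-δ-mulMono e a q ⟩
    (if dividesMono a e then coeff q (quotMono e a) else 0ℤ) ≡⟨ cong (λ z → if dividesMono a e then z else 0ℤ) (q≈r _) ⟩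
    (if dividesMono a e then coeff r (quotMono e a) else 0ℤ) ≡⟨ linExt-δ-mulMono e a r ⟨
    linExt (λ b → δ e (mulMono a b)) r                       ∎

linExt-constS-⊛ : ∀ g p S n → linExt g ((constS p ⊛ S) n) ≡ linExt g (mulP p (S n))
linExt-constS-⊛ g p S n = begin
  linExt g ((constS p ⊛ S) n)                          ≡⟨ linExt-++ g (mulP p (S n)) _ ⟩
  linExt g (mulP p (S n)) +ℤ linExt g (sumP (map _ (applyUpTo suc n)))
    ≡⟨ cong (λ z → linExt g (mulP p (S n)) +ℤ linExt g z) (higher-terms n (λ i → i)) ⟩
  linExt g (mulP p (S n)) +ℤ 0ℤ                        ≡⟨ ℤP.+-identityʳ _ ⟩
  linExt g (mulP p (S n))                              ∎
  where
  higher-terms : ∀ m (f : ℕ → ℕ) →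
    sumP (map (λ k → mulP (constS p k) (S (n ∸ k))) (applyUpTo (λ i → suc (f i)) m)) ≡ []
  higher-terms zero    f = refl
  higher-terms (suc m) f = higher-terms m (λ i → f (suc i))

revQs≡map-⊘ : ∀ N D n → revQs N D n ≡ map (λ k → (N ⊘ D) (n ∸ k)) (upTo (suc n))
revQs≡map-⊘ N D zero    = refl
revQs≡map-⊘ N D (suc n) = cong ((N ⊘ D) (suc n) ∷_) (begin
  revQs N D n                                            ≡⟨ revQs≡map-⊘ N D n ⟩
  map (λ k → (N ⊘ D) (n ∸ k)) (applyUpTo (λ i → i) (suc n)) ≡⟨ map-applyUpTo (λ i → i) _ (suc n) ⟩
  applyUpTo (λ k → (N ⊘ D) (n ∸ k)) (suc n)              ≡⟨ map-applyUpTo suc (λ k → (N ⊘ D) (suc n ∸ k)) (suc n) ⟨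
  map (λ k → (N ⊘ D) (suc n ∸ k)) (applyUpTo suc (suc n)) ∎)

zipWith-map-map : ∀ {A B C E : Set} (f : B → C → E) (g : A → B) (h : A → C) xs →
                  zipWith f (map g xs) (map h xs) ≡ map (λ x → f (g x) (h x)) xs
zipWith-map-map f g h []       = refl
zipWith-map-map f g h (x ∷ xs) = cong (f (g x) (h x) ∷_) (zipWith-map-map f g h xs)

coeff-⊘-suc : ∀ N D n e →
  coeff ((N ⊘ D) (suc n)) e
    ≡ coeff (N (suc n)) e +ℤ - sumBy (λ k → coeff (mulP (D (suc k)) ((N ⊘ D) (n ∸ k))) e) (upTo (suc n))
coeff-⊘-suc N D n e = begin
  coeff ((N ⊘ D) (suc n)) e
    ≡⟨ coeff≡linExt-δ ((N ⊘ D) (suc n)) e ⟩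
  linExt (δ e) (N (suc n) ++ negP (sumP (zipWith mulP Ds (revQs N D n))))
    ≡⟨ linExt-++ (δ e) (N (suc n)) _ ⟩
  linExt (δ e) (N (suc n)) +ℤ linExt (δ e) (negP (sumP (zipWith mulP Ds (revQs N D n))))
    ≡⟨ cong₂ _+ℤ_ (sym (coeff≡linExt-δ (N (suc n)) e)) (linExt-negP (δ e) (sumP (zipWith mulP Ds (revQs N D n)))) ⟩
  coeff (N (suc n)) e +ℤ - linExt (δ e) (sumP (zipWith mulP Ds (revQs N D n)))
    ≡⟨ cong (λ z → coeff (N (suc n)) e +ℤ - z) subtracted ⟩
  coeff (N (suc n)) e +ℤ - sumBy (λ k → coeff (term k) e) (upTo (suc n)) ∎
  where
  Ds = map (λ k → D (suc k)) (upTo (suc n))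
  Q↓ = λ k → (N ⊘ D) (n ∸ k)
  term = λ k → mulP (D (suc k)) (Q↓ k)
  subtracted : linExt (δ e) (sumP (zipWith mulP Ds (revQs N D n))) ≡ sumBy (λ k → coeff (term k) e) (upTo (suc n))
  subtracted = begin
    linExt (δ e) (sumP (zipWith mulP Ds (revQs N D n)))
      ≡⟨ cong (λ qs → linExt (δ e) (sumP (zipWith mulP Ds qs))) (revQs≡map-⊘ N D n) ⟩
    linExt (δ e) (sumP (zipWith mulP Ds (map Q↓ (upTo (suc n)))))
      ≡⟨ cong (λ ps → linExt (δ e) (sumP ps)) (zipWith-map-map mulP (λ k → D (suc k)) Q↓ (upTo (suc n))) ⟩
    linExt (δ e) (sumP (map term (upTo (suc n))))
      ≡⟨ linExt-sumP (δ e) (map term (upTo (suc n))) ⟩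
    sumBy (linExt (δ e)) (map term (upTo (suc n)))
      ≡⟨ sumBy-map (linExt (δ e)) term (upTo (suc n)) ⟩
    sumBy (λ k → linExt (δ e) (term k)) (upTo (suc n))
      ≡⟨ sumBy-cong (λ k → sym (coeff≡linExt-δ (term k) e)) (upTo (suc n)) ⟩
    sumBy (λ k → coeff (term k) e) (upTo (suc n)) ∎

⊘-unique : ∀ N D T → N 0 ≈P T 0 →
  (∀ n e → coeff (T (suc n)) e
             ≡ coeff (N (suc n)) e +ℤ - sumBy (λ k → coeff (mulP (D (suc k)) (T (n ∸ k))) e) (upTo (suc n))) →
  (N ⊘ D) ≈S T
⊘-unique N D T N0≈T0 T-rec m = bounded m m ℕP.≤-refl
  where
  bounded : ∀ b m → m ≤ b → (N ⊘ D) m ≈P T m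
  bounded b       zero    _         = N0≈T0
  bounded (suc b) (suc m) (s≤s m≤b) e = begin
    coeff ((N ⊘ D) (suc m)) e
      ≡⟨ coeff-⊘-suc N D m e ⟩
    coeff (N (suc m)) e +ℤ - sumBy (λ k → coeff (mulP (D (suc k)) ((N ⊘ D) (m ∸ k))) e) (upTo (suc m))
      ≡⟨ cong (λ z → coeff (N (suc m)) e +ℤ - z) (sumBy-cong shorter (upTo (suc m))) ⟩
    coeff (N (suc m)) e +ℤ - sumBy (λ k → coeff (mulP (D (suc k)) (T (m ∸ k))) e) (upTo (suc m))
      ≡⟨ T-rec m e ⟨
    coeff (T (suc m)) e ∎
    where
    shorter : ∀ k → coeff (mulP (D (suc k)) ((N ⊘ D) (m ∸ k))) e ≡ coeff (mulP (D (suc k)) (T (m ∸ k))) e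
    shorter k = mulP-congʳ (D (suc k)) (bounded b (m ∸ k) (ℕP.≤-trans (ℕP.m∸n≤m m k) m≤b)) e

module _ {A : Set} where

  ∈-middle⁻ : ∀ (a : List A) {x b z} → z ∈ a ++ x ∷ b → z ≡ x ⊎ z ∈ a ++ b
  ∈-middle⁻ a {x} {b} z∈ with ↭.∈-resp-↭ (↭.shift x a b) z∈
  ... | here z≡x = inj₁ z≡x
  ... | there z∈ab = inj₂ z∈ab

  ∈-middle⁺ : ∀ (a : List A) {x b z} → z ∈ a ++ b → z ∈ a ++ x ∷ b
  ∈-middle⁺ a {x} {b} z∈ = ↭.∈-resp-↭ (↭-sym (↭.shift x a b)) (there z∈)

  ++-∷-cancel : ∀ x (a b a′ b′ : List A) → x ∉ a → x ∉ a′ → a ++ x ∷ b ≡ a′ ++ x ∷ b′ → a ≡ a′ × b ≡ b′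
  ++-∷-cancel x []      b []       b′ _  _  refl = refl , refl
  ++-∷-cancel x []      b (_ ∷ a′) b′ _  x∉ refl = ⊥-elim (x∉ (here refl))
  ++-∷-cancel x (_ ∷ a) b []       b′ x∉ _  refl = ⊥-elim (x∉ (here refl))
  ++-∷-cancel x (y ∷ a) b (_ ∷ a′) b′ x∉ x∉′ eq with ∷-injective eq
  ... | refl , eq′ with ++-∷-cancel x a b a′ b′ (λ m → x∉ (there m)) (λ m → x∉′ (there m)) eq′
  ... | refl , refl = refl , refl

  ++-≡-++-∷ : ∀ (a b p : List A) x q → a ++ b ≡ p ++ x ∷ q →
              (∃ λ a₂ → a ≡ p ++ x ∷ a₂ × q ≡ a₂ ++ b) ⊎ (∃ λ b₁ → b ≡ b₁ ++ x ∷ q × p ≡ a ++ b₁)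
  ++-≡-++-∷ []      b p       x q eq = inj₂ (p , eq , refl)
  ++-≡-++-∷ (y ∷ a) b []      x q eq with ∷-injective eq
  ... | refl , eq′ = inj₁ (a , refl , sym eq′)
  ++-≡-++-∷ (y ∷ a) b (z ∷ p) x q eq with ∷-injective eq
  ... | refl , eq′ with ++-≡-++-∷ a b p x q eq′
  ... | inj₁ (a₂ , refl , eq″) = inj₁ (a₂ , refl , eq″)
  ... | inj₂ (b₁ , eq″ , refl) = inj₂ (b₁ , eq″ , refl)

  ∷ʳ-≡-∷ʳ : ∀ (a b τ : List A) x → a ++ x ∷ b ≡ τ ++ x ∷ [] → (b ≡ [] × a ≡ τ) ⊎ x ∈ b
  ∷ʳ-≡-∷ʳ []          b []      x eq with ∷-injective eq
  ... | _ , refl = inj₁ (refl , refl)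
  ∷ʳ-≡-∷ʳ []          b (t ∷ τ) x eq with ∷-injective eq
  ... | refl , refl = inj₂ (∈-++⁺ʳ τ (here refl))
  ∷ʳ-≡-∷ʳ (u ∷ [])    b []      x eq with ∷-injective eq
  ... | _ , ()
  ∷ʳ-≡-∷ʳ (u ∷ _ ∷ a) b []      x eq with ∷-injective eq
  ... | _ , ()
  ∷ʳ-≡-∷ʳ (u ∷ a)     b (t ∷ τ) x eq with ∷-injective eq
  ... | refl , eq′ with ∷ʳ-≡-∷ʳ a b τ x eq′
  ... | inj₁ (refl , refl) = inj₁ (refl , refl)
  ... | inj₂ x∈b = inj₂ x∈b

  ∷ʳ-nonempty : ∀ (xs : List A) x → ∃₂ λ y ys → xs ++ x ∷ [] ≡ y ∷ ys
  ∷ʳ-nonempty []       x = x , [] , refl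
  ∷ʳ-nonempty (y ∷ xs) x = y , xs ++ x ∷ [] , refl

module _ {A B : Set} where

  map-≡-++ : ∀ (f : A → B) xs (p q : List B) → map f xs ≡ p ++ q →
             ∃₂ λ u v → xs ≡ u ++ v × map f u ≡ p × map f v ≡ q
  map-≡-++ f xs       []      q eq = [] , xs , refl , refl , eq
  map-≡-++ f (x ∷ xs) (y ∷ p) q eq with ∷-injective eq
  ... | refl , eq′ with map-≡-++ f xs p q eq′
  ... | u , v , refl , refl , refl = x ∷ u , v , refl , refl , refl

  Unique-concatMap⁺ : ∀ (F : A → List B) {xs} → Unique xs → (∀ {x} → x ∈ xs → Unique (F x)) →
                      (∀ {x x′ z} → x ∈ xs → x′ ∈ xs → z ∈ F x → z ∈ F x′ → x ≡ x′) →
                      Unique (concatMap F xs)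
  Unique-concatMap⁺ F {[]}     _           _       _        = []
  Unique-concatMap⁺ F {x ∷ xs} xxs!@(_ ∷ xs!) F-unique F-disjoint =
    Unique.++⁺ (F-unique (here refl))
               (Unique-concatMap⁺ F xs! (λ m → F-unique (there m)) (λ m m′ → F-disjoint (there m) (there m′)))
               disjoint
    where
    disjoint : ∀ {v} → ¬ (v ∈ F x × v ∈ concatMap F xs)
    disjoint (v∈Fx , v∈rest) with find (∈-concatMap⁻ F v∈rest)
    ... | x′ , x′∈xs , v∈Fx′ with F-disjoint (here refl) (there x′∈xs) v∈Fx v∈Fx′
    ... | refl = Unique.Unique[x∷xs]⇒x∉xs xxs! x′∈xs

Within : ℕ → List ℕ → Set
Within n σ = ∀ {x} → x ∈ σ → 1 ≤ x × x ≤ n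

insertions⁻ : ∀ x ρ {σ} → σ ∈ insertions x ρ → ∃₂ λ a b → σ ≡ a ++ x ∷ b × ρ ≡ a ++ b
insertions⁻ x []       (here refl) = [] , [] , refl , refl
insertions⁻ x (y ∷ ys) (here refl) = [] , y ∷ ys , refl , refl
insertions⁻ x (y ∷ ys) (there σ∈) with ∈-map⁻ (y ∷_) σ∈
... | _ , σ′∈ , refl with insertions⁻ x ys σ′∈
... | a , b , refl , refl = y ∷ a , b , refl , refl

insertions⁺ : ∀ x a b → a ++ x ∷ b ∈ insertions x (a ++ b)
insertions⁺ x []      []      = here refl
insertions⁺ x []      (y ∷ b) = here refl
insertions⁺ x (y ∷ a) b       = there (∈-map⁺ (y ∷_) (insertions⁺ x a b))

perms⁻ : ∀ n {σ} → σ ∈ perms (suc n) → ∃₂ λ a b → σ ≡ a ++ suc n ∷ b × a ++ b ∈ perms n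
perms⁻ n σ∈ with find (∈-concatMap⁻ (insertions (suc n)) σ∈)
... | ρ , ρ∈ , σ∈ins with insertions⁻ (suc n) ρ σ∈ins
... | a , b , refl , refl = a , b , refl , ρ∈

perms⁺ : ∀ n a b → a ++ b ∈ perms n → a ++ suc n ∷ b ∈ perms (suc n)
perms⁺ n a b ρ∈ = ∈-concatMap⁺ (insertions (suc n)) (lose ρ∈ (insertions⁺ (suc n) a b))

perms-within : ∀ n {σ} → σ ∈ perms n → Within n σ
perms-within zero    (here refl) ()
perms-within (suc n) σ∈ {x} x∈ with perms⁻ n σ∈
... | a , b , refl , ρ∈ with ∈-middle⁻ a x∈
... | inj₁ refl = s≤s z≤n , ℕP.≤-refl
... | inj₂ x∈ρ  = let 1≤x , x≤n = perms-within n ρ∈ x∈ρ in 1≤x , ℕP.m≤n⇒m≤1+n x≤n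

within-< : ∀ {n σ} → Within n σ → ∀ {z} → z ∈ σ → z < suc n
within-< σ-within z∈ = s≤s (proj₂ (σ-within z∈))

perms-length : ∀ n {σ} → σ ∈ perms n → length σ ≡ n
perms-length zero    (here refl) = refl
perms-length (suc n) σ∈ with perms⁻ n σ∈
... | a , b , refl , ρ∈ = begin
  length (a ++ suc n ∷ b)     ≡⟨ length-++ a ⟩
  length a + suc (length b)   ≡⟨ ℕP.+-suc (length a) (length b) ⟩
  suc (length a + length b)   ≡⟨ cong suc (sym (length-++ a)) ⟩
  suc (length (a ++ b))       ≡⟨ cong suc (perms-length n ρ∈) ⟩
  suc n                       ∎

max∈perms : ∀ n {σ} → σ ∈ perms (suc n) → suc n ∈ σ
max∈perms n σ∈ with perms⁻ n σ∈
... | a , b , refl , _ = ∈-insert a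

1∈perms : ∀ n {σ} → σ ∈ perms (suc n) → 1 ∈ σ
1∈perms zero    σ∈ with perms⁻ zero σ∈
... | []    , []    , refl , _ = here refl
... | []    , _ ∷ _ , refl , here ()
... | _ ∷ _ , _     , refl , here ()
1∈perms (suc n) σ∈ with perms⁻ (suc n) σ∈
... | a , b , refl , ρ∈ = ∈-middle⁺ a (1∈perms n ρ∈)

max∉perms : ∀ n {σ} → σ ∈ perms n → suc n ∉ σ
max∉perms n σ∈ m = ℕP.<-irrefl refl (proj₂ (perms-within n σ∈ m))

insertions-unique : ∀ x ρ → x ∉ ρ → Unique (insertions x ρ)
insertions-unique x []       _   = [] ∷ []
insertions-unique x (y ∷ ys) x∉ =
  head-fresh (insertions x ys) ∷ Unique.map⁺ ∷-injectiveʳ (insertions-unique x ys (λ m → x∉ (there m)))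
  where
  head-fresh : ∀ zs → All (λ z → (x ∷ y ∷ ys) ≢ z) (map (y ∷_) zs)
  head-fresh []       = []
  head-fresh (z ∷ zs) = (λ eq → x∉ (here (proj₁ (∷-injective eq)))) ∷ head-fresh zs

perms-unique : ∀ n → Unique (perms n)
perms-unique zero    = [] ∷ []
perms-unique (suc n) =
  Unique-concatMap⁺ (insertions (suc n)) (perms-unique n)
    (λ ρ∈ → insertions-unique (suc n) _ (max∉perms n ρ∈)) disjoint
  where
  disjoint : ∀ {ρ ρ′ σ} → ρ ∈ perms n → ρ′ ∈ perms n →
             σ ∈ insertions (suc n) ρ → σ ∈ insertions (suc n) ρ′ → ρ ≡ ρ′
  disjoint {ρ} {ρ′} ρ∈ ρ′∈ σ∈ σ∈′ with insertions⁻ (suc n) ρ σ∈ | insertions⁻ (suc n) ρ′ σ∈′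
  ... | a , b , refl , refl | a′ , b′ , eq , refl
    with ++-∷-cancel (suc n) a b a′ b′ (λ m → max∉perms n ρ∈ (∈-++⁺ˡ m)) (λ m → max∉perms n ρ′∈ (∈-++⁺ˡ m)) eq
  ... | refl , refl = refl

shift : ℕ → List ℕ → List ℕ
shift c = map (c +_)

shift-++-∷ : ∀ c u x v → shift c (u ++ x ∷ v) ≡ shift c u ++ (c + x) ∷ shift c v
shift-++-∷ c u x v = map-++ (c +_) u (x ∷ v)

shift-injective : ∀ c {xs ys} → shift c xs ≡ shift c ys → xs ≡ ys
shift-injective c = map-injective (ℕP.+-cancelˡ-≡ c _ _)

length-shift : ∀ c l → length (shift c l) ≡ length l
length-shift c = length-map (c +_)

shift-≡-∷ʳ : ∀ c τ₀ p x → shift c τ₀ ≡ p ++ x ∷ [] → ∃₂ λ τ t → τ₀ ≡ τ ++ t ∷ [] × c + t ≡ x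
shift-≡-∷ʳ c τ₀ p x eq with map-≡-++ (c +_) τ₀ p (x ∷ []) eq
... | τ , t ∷ [] , refl , _ , c+t∷[]≡x∷[] = τ , t , refl , proj₁ (∷-injective c+t∷[]≡x∷[])

perms-∷ʳ⁻ : ∀ k τ → τ ++ suc k ∷ [] ∈ perms (suc k) → τ ∈ perms k
perms-∷ʳ⁻ k τ τk∈ with perms⁻ k τk∈
... | a , b , eq , ab∈ with ∷ʳ-≡-∷ʳ a b τ (suc k) (sym eq)
... | inj₁ (refl , refl) = subst (_∈ perms k) (++-identityʳ a) ab∈
... | inj₂ k∈b           = ⊥-elim (max∉perms k ab∈ (∈-++⁺ʳ a k∈b))

∷ʳ-odd∈perms : ∀ k τ → even k ≡ false → τ ∈ perms (k ∸ 1) → τ ++ k ∷ [] ∈ perms k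
∷ʳ-odd∈perms (suc k) τ _ τ∈ = perms⁺ k τ [] (subst (_∈ perms k) (sym (++-identityʳ τ)) τ∈)

perms-pred-< : ∀ k {τ} → 1 ≤ k → τ ∈ perms (k ∸ 1) → ∀ {z} → z ∈ τ → z < k
perms-pred-< (suc k) _ τ∈ = within-< (perms-within k τ∈)

perms-split : ∀ N a b → a ++ b ∈ perms N → (∀ {u w} → u ∈ a → w ∈ b → w ≤ u) →
              b ∈ perms (length b) × ∃ λ τ → τ ∈ perms (length a) × a ≡ shift (length b) τ
perms-split zero    []      []      ab∈        _     = ab∈ , [] , here refl , refl
perms-split zero    []      (_ ∷ _) (here ()) _
perms-split zero    (_ ∷ _) _       (here ()) _
perms-split (suc M) a       b       ab∈        a≥b with perms⁻ M ab∈
... | p , q , eq , pq∈ with ++-≡-++-∷ a b p (suc M) q eq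
... | inj₂ (b₁ , refl , refl) = max-in-b a refl
  where
  max-in-b : ∀ a₀ → a₀ ≡ a → b ∈ perms (length b) × ∃ λ τ → τ ∈ perms (length a) × a ≡ shift (length b) τ
  max-in-b []      refl = subst (λ m → b ∈ perms m) (sym (perms-length (suc M) ab∈)) ab∈ , [] , here refl , refl
  max-in-b (u ∷ _) refl = ⊥-elim (ℕP.<-irrefl refl
    (ℕP.≤-trans (s≤s (proj₂ (perms-within M pq∈ (here refl)))) (a≥b (here refl) (∈-insert b₁))))
... | inj₁ (a₂ , refl , refl)
  with perms-split M (p ++ a₂) b (subst (_∈ perms M) (sym (++-assoc p a₂ b)) pq∈) (λ u∈ w∈ → a≥b (∈-middle⁺ p u∈) w∈)
... | b∈ , τ₁ , τ₁∈ , eq₁ with map-≡-++ (length b +_) τ₁ p a₂ (sym eq₁)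
... | u₁ , v₁ , refl , refl , refl = b∈ , u₁ ++ L ∷ v₁ , τ∈ , a≡
  where
  c = length b
  L = length (shift c u₁ ++ suc M ∷ shift c v₁)
  shifted-length : length (shift c u₁ ++ shift c v₁) ≡ length (u₁ ++ v₁)
  shifted-length = trans (cong length (sym (map-++ (c +_) u₁ v₁))) (length-shift c (u₁ ++ v₁))
  L≡ : L ≡ suc (length (u₁ ++ v₁))
  L≡ = begin
    L                                                ≡⟨ length-++ (shift c u₁) ⟩
    length (shift c u₁) + suc (length (shift c v₁))  ≡⟨ ℕP.+-suc _ _ ⟩
    suc (length (shift c u₁) + length (shift c v₁))  ≡⟨ cong suc (sym (length-++ (shift c u₁))) ⟩
    suc (length (shift c u₁ ++ shift c v₁))          ≡⟨ cong suc shifted-length ⟩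
    suc (length (u₁ ++ v₁))                          ∎
  τ∈ : u₁ ++ L ∷ v₁ ∈ perms L
  τ∈ = subst (λ z → u₁ ++ z ∷ v₁ ∈ perms z) (sym L≡)
             (perms⁺ _ u₁ v₁ (subst (λ z → u₁ ++ v₁ ∈ perms z) shifted-length τ₁∈))
  M≡ : suc M ≡ c + L
  M≡ = begin
    suc M                                    ≡⟨ sym (perms-length (suc M) ab∈) ⟩
    length ((shift c u₁ ++ suc M ∷ shift c v₁) ++ b) ≡⟨ length-++ (shift c u₁ ++ suc M ∷ shift c v₁) ⟩
    L + c                                    ≡⟨ ℕP.+-comm L c ⟩
    c + L                                    ∎
  a≡ : shift c u₁ ++ suc M ∷ shift c v₁ ≡ shift c (u₁ ++ L ∷ v₁)
  a≡ = trans (cong (λ z → shift c u₁ ++ z ∷ shift c v₁) M≡) (sym (shift-++-∷ c u₁ L v₁))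

perms-join : ∀ k c τ β → τ ∈ perms k → β ∈ perms c → shift c τ ++ β ∈ perms (k + c)
perms-join zero    c .[] β (here refl) β∈ = β∈
perms-join (suc k) c τ   β τ∈         β∈ with perms⁻ k τ∈
... | u , v , refl , uv∈ =
  subst (_∈ perms (suc (k + c))) (sym split)
        (perms⁺ (k + c) (shift c u) (shift c v ++ β)
                (subst (_∈ perms (k + c)) reassoc (perms-join k c (u ++ v) β uv∈ β∈)))
  where
  split : shift c (u ++ suc k ∷ v) ++ β ≡ shift c u ++ suc (k + c) ∷ (shift c v ++ β)
  split = begin
    shift c (u ++ suc k ∷ v) ++ β                ≡⟨ cong (_++ β) (shift-++-∷ c u (suc k) v) ⟩
    (shift c u ++ (c + suc k) ∷ shift c v) ++ β  ≡⟨ ++-assoc (shift c u) _ β ⟩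
    shift c u ++ (c + suc k) ∷ (shift c v ++ β)  ≡⟨ cong (λ z → shift c u ++ z ∷ (shift c v ++ β)) (ℕP.+-comm c (suc k)) ⟩
    shift c u ++ suc (k + c) ∷ (shift c v ++ β)  ∎
  reassoc : shift c (u ++ v) ++ β ≡ shift c u ++ (shift c v ++ β)
  reassoc = trans (cong (_++ β) (map-++ (c +_) u v)) (++-assoc (shift c u) (shift c v) β)

-- The Dumont condition

dumontStep : ℕ → ℕ → Bool
dumontStep a b = if even a then b <ᵇ a else a <ᵇ b

dumontStep-even : ∀ {a b} → even a ≡ true → dumontStep a b ≡ true → b < a
dumontStep-even {a} {b} a-even step = <ᵇ⇒< (trans (sym (cong (λ t → if t then b <ᵇ a else a <ᵇ b) a-even)) step)

dumontStep-odd : ∀ {a b} → even a ≡ false → dumontStep a b ≡ true → a < b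
dumontStep-odd {a} {b} a-odd step = <ᵇ⇒< (trans (sym (cong (λ t → if t then b <ᵇ a else a <ᵇ b) a-odd)) step)

isDumont-tail : ∀ a l → isDumont (a ∷ l) ≡ true → isDumont l ≡ true
isDumont-tail a []      _ = refl
isDumont-tail a (b ∷ r) p = proj₂ (∧-true⁻ {dumontStep a b} p)

isDumont-++⁻ʳ : ∀ xs ys → isDumont (xs ++ ys) ≡ true → isDumont ys ≡ true
isDumont-++⁻ʳ []       ys p = p
isDumont-++⁻ʳ (x ∷ xs) ys p = isDumont-++⁻ʳ xs ys (isDumont-tail x (xs ++ ys) p)

isDumont-step : ∀ xs a b ys → isDumont (xs ++ a ∷ b ∷ ys) ≡ true → dumontStep a b ≡ true
isDumont-step []       a b ys p = proj₁ (∧-true⁻ p)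
isDumont-step (x ∷ xs) a b ys p = isDumont-step xs a b ys (isDumont-tail x (xs ++ a ∷ b ∷ ys) p)

isDumont-last : ∀ xs a → isDumont (xs ++ a ∷ []) ≡ true → odd a ≡ true
isDumont-last []       a p = p
isDumont-last (x ∷ xs) a p = isDumont-last xs a (isDumont-tail x (xs ++ a ∷ []) p)

isDumont-cut : ∀ xs y ys → isDumont (xs ++ y ∷ ys) ≡ true → odd y ≡ true → isDumont (xs ++ y ∷ []) ≡ true
isDumont-cut []            y ys p y-odd = y-odd
isDumont-cut (x ∷ [])      y ys p y-odd = ∧-true⁺ (proj₁ (∧-true⁻ p)) y-odd
isDumont-cut (x ∷ x′ ∷ xs) y ys p y-odd =
  ∧-true⁺ (proj₁ (∧-true⁻ p)) (isDumont-cut (x′ ∷ xs) y ys (proj₂ (∧-true⁻ {dumontStep x x′} p)) y-odd)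

isDumont-join : ∀ xs x y ys → isDumont (xs ++ x ∷ []) ≡ true → dumontStep x y ≡ true →
                isDumont (y ∷ ys) ≡ true → isDumont (xs ++ x ∷ y ∷ ys) ≡ true
isDumont-join []             x y ys p s q = ∧-true⁺ s q
isDumont-join (x₁ ∷ [])      x y ys p s q = ∧-true⁺ {dumontStep x₁ x} (proj₁ (∧-true⁻ p)) (∧-true⁺ s q)
isDumont-join (x₁ ∷ x₂ ∷ xs) x y ys p s q =
  ∧-true⁺ (proj₁ (∧-true⁻ p)) (isDumont-join (x₂ ∷ xs) x y ys (proj₂ (∧-true⁻ {dumontStep x₁ x₂} p)) s q)

isDumont-∷ʳ-max : ∀ l x → (∀ {z} → z ∈ l → z < x) → odd x ≡ true → isDumont (l ++ x ∷ []) ≡ isDumont l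
isDumont-∷ʳ-max []          x l<x x-odd = x-odd
isDumont-∷ʳ-max (a ∷ [])    x l<x x-odd = trans (cong₂ _∧_ (step (even a)) x-odd) (BoolP.∧-identityʳ _)
  where
  step : ∀ e → (if e then x <ᵇ a else a <ᵇ x) ≡ not e
  step true  = ≥⇒≮ᵇ (ℕP.<⇒≤ (l<x (here refl)))
  step false = <⇒<ᵇ (l<x (here refl))
isDumont-∷ʳ-max (a ∷ b ∷ l) x l<x x-odd = cong (dumontStep a b ∧_) (isDumont-∷ʳ-max (b ∷ l) x (λ m → l<x (there m)) x-odd)

isDumont-max-∷ : ∀ N β → even N ≡ true → (∀ {z} → z ∈ β → z < N) → 1 ≤ length β →
                 isDumont β ≡ true → isDumont (N ∷ β) ≡ true
isDumont-max-∷ N (y ∷ β) N-even β<N _ d =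
  ∧-true⁺ (trans (cong (λ t → if t then y <ᵇ N else N <ᵇ y) N-even) (<⇒<ᵇ (β<N (here refl)))) d

isDumont-shift : ∀ c l → even c ≡ true → isDumont (shift c l) ≡ isDumont l
isDumont-shift c []          _      = refl
isDumont-shift c (a ∷ [])    c-even = cong not (even-+ c a c-even)
isDumont-shift c (a ∷ b ∷ l) c-even = cong₂ _∧_ step (isDumont-shift c (b ∷ l) c-even)
  where
  step : dumontStep (c + a) (c + b) ≡ dumontStep a b
  step rewrite even-+ c a c-even | +-<ᵇ-+ c a b | +-<ᵇ-+ c b a = refl

-- The pattern 1-3-2

someBetween : ℕ → ℕ → List ℕ → Bool
someBetween a y = foldr (λ z acc → ((a <ᵇ z) ∧ (z <ᵇ y)) ∨ acc) false

someBetween-++ : ∀ a y zs ws → someBetween a y (zs ++ ws) ≡ (someBetween a y zs ∨ someBetween a y ws)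
someBetween-++ a y []       ws = refl
someBetween-++ a y (z ∷ zs) ws rewrite someBetween-++ a y zs ws = sym (BoolP.∨-assoc ((a <ᵇ z) ∧ (z <ᵇ y)) _ _)

someBetween-below : ∀ a y ws → (∀ {z} → z ∈ ws → z < a) → someBetween a y ws ≡ false
someBetween-below a y []       ws<a = refl
someBetween-below a y (w ∷ ws) ws<a rewrite ≥⇒≮ᵇ {a} {w} (ℕP.<⇒≤ (ws<a (here refl))) =
  someBetween-below a y ws (λ m → ws<a (there m))

someBetween-∷ʳ-above : ∀ a y zs x → y < x → someBetween a y (zs ++ x ∷ []) ≡ someBetween a y zs
someBetween-∷ʳ-above a y []       x y<x rewrite ≥⇒≮ᵇ {x} {y} (ℕP.<⇒≤ y<x) | BoolP.∧-zeroʳ (a <ᵇ x) = refl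
someBetween-∷ʳ-above a y (z ∷ zs) x y<x rewrite someBetween-∷ʳ-above a y zs x y<x = refl

someBetween-shift : ∀ c a y zs → someBetween (c + a) (c + y) (shift c zs) ≡ someBetween a y zs
someBetween-shift c a y []       = refl
someBetween-shift c a y (z ∷ zs) rewrite +-<ᵇ-+ c a z | +-<ᵇ-+ c z y | someBetween-shift c a y zs = refl

someBetween-witness : ∀ u y b w → w ∈ b → u < w → w < y → someBetween u y b ≡ true
someBetween-witness u y (z ∷ b) w (here refl) u<w w<y rewrite <⇒<ᵇ u<w | <⇒<ᵇ w<y = refl
someBetween-witness u y (z ∷ b) w (there w∈)  u<w w<y = ∨-trueʳ ((u <ᵇ z) ∧ (z <ᵇ y)) (someBetween-witness u y b w w∈ u<w w<y)

has32above-++⁻ˡ : ∀ a xs ys → has32above a (xs ++ ys) ≡ false → has32above a xs ≡ false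
has32above-++⁻ˡ a []       ys p = refl
has32above-++⁻ˡ a (y ∷ xs) ys p with ∨-false⁻ {someBetween a y (xs ++ ys)} p
... | p₁ , p₂ rewrite someBetween-++ a y xs ys =
  ∨-false⁺ (proj₁ (∨-false⁻ p₁)) (has32above-++⁻ˡ a xs ys p₂)

has32above-below : ∀ a ws → (∀ {z} → z ∈ ws → z < a) → has32above a ws ≡ false
has32above-below a []       ws<a = refl
has32above-below a (y ∷ ws) ws<a rewrite someBetween-below a y ws (λ m → ws<a (there m)) =
  has32above-below a ws (λ m → ws<a (there m))

has32above-++-below : ∀ a A B → (∀ {z} → z ∈ B → z < a) → has32above a A ≡ false → has32above a (A ++ B) ≡ false
has32above-++-below a []      B B<a p = has32above-below a B B<a
has32above-++-below a (y ∷ A) B B<a p with ∨-false⁻ {someBetween a y A} p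
... | p₁ , p₂ rewrite someBetween-++ a y A B | p₁ | someBetween-below a y B B<a = has32above-++-below a A B B<a p₂

has32above-∷ʳ-max : ∀ a l x → (∀ {z} → z ∈ l → z < x) → has32above a (l ++ x ∷ []) ≡ has32above a l
has32above-∷ʳ-max a []      x l<x = refl
has32above-∷ʳ-max a (y ∷ l) x l<x
  rewrite someBetween-∷ʳ-above a y l x (l<x (here refl)) | has32above-∷ʳ-max a l x (λ m → l<x (there m)) = refl

has32above-shift : ∀ c a l → has32above (c + a) (shift c l) ≡ has32above a l
has32above-shift c a []      = refl
has32above-shift c a (y ∷ l) rewrite someBetween-shift c a y l | has32above-shift c a l = refl

has32above-witness : ∀ u a₂ y b w → w ∈ b → u < w → w < y → has32above u (a₂ ++ y ∷ b) ≡ true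
has32above-witness u []       y b w w∈ u<w w<y = ∨-trueˡ (has32above u b) (someBetween-witness u y b w w∈ u<w w<y)
has32above-witness u (x ∷ a₂) y b w w∈ u<w w<y = ∨-trueʳ (someBetween u x (a₂ ++ y ∷ b)) (has32above-witness u a₂ y b w w∈ u<w w<y)

contains132-++⁻ʳ : ∀ xs ys → contains132 (xs ++ ys) ≡ false → contains132 ys ≡ false
contains132-++⁻ʳ []       ys p = p
contains132-++⁻ʳ (x ∷ xs) ys p = contains132-++⁻ʳ xs ys (proj₂ (∨-false⁻ {has32above x (xs ++ ys)} p))

contains132-++⁻ˡ : ∀ xs ys → contains132 (xs ++ ys) ≡ false → contains132 xs ≡ false
contains132-++⁻ˡ []       ys p = refl
contains132-++⁻ˡ (x ∷ xs) ys p with ∨-false⁻ {has32above x (xs ++ ys)} p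
... | p₁ , p₂ = ∨-false⁺ (has32above-++⁻ˡ x xs ys p₁) (contains132-++⁻ˡ xs ys p₂)

contains132-shift : ∀ c l → contains132 (shift c l) ≡ contains132 l
contains132-shift c []      = refl
contains132-shift c (a ∷ l) rewrite has32above-shift c a l | contains132-shift c l = refl

contains132-∷ʳ-max : ∀ l x → (∀ {z} → z ∈ l → z < x) → contains132 (l ++ x ∷ []) ≡ contains132 l
contains132-∷ʳ-max []      x l<x = refl
contains132-∷ʳ-max (a ∷ l) x l<x
  rewrite has32above-∷ʳ-max a l x (λ m → l<x (there m)) | contains132-∷ʳ-max l x (λ m → l<x (there m)) = refl

contains132-max-∷ : ∀ N l → (∀ {z} → z ∈ l → z < N) → contains132 (N ∷ l) ≡ contains132 l
contains132-max-∷ N l l<N rewrite has32above-below N l l<N = refl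

contains132-++-above : ∀ A B → (∀ {u w} → u ∈ A → w ∈ B → w < u) →
                       contains132 A ≡ false → contains132 B ≡ false → contains132 (A ++ B) ≡ false
contains132-++-above []      B B<A pA pB = pB
contains132-++-above (a ∷ A) B B<A pA pB with ∨-false⁻ {has32above a A} pA
... | p₁ , p₂ = ∨-false⁺ (has32above-++-below a A B (B<A (here refl)) p₁)
                         (contains132-++-above A B (λ u∈ w∈ → B<A (there u∈) w∈) p₂ pB)

avoids132-split : ∀ a N b → contains132 (a ++ N ∷ b) ≡ false → (∀ {w} → w ∈ b → w < N) →
                  ∀ {u w} → u ∈ a → w ∈ b → w ≤ u
avoids132-split a N b avoids b<N {u} {w} u∈ w∈ with ∈-∃++ u∈
... | a₁ , a₂ , refl with w ≤? u
... | yes w≤u = w≤u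
... | no  w≰u = ⊥-elim (true≢false (begin
  true                                 ≡⟨ sym (contains132-witness a₁) ⟩
  contains132 (a₁ ++ u ∷ a₂ ++ N ∷ b)  ≡⟨ cong contains132 (sym (++-assoc a₁ (u ∷ a₂) (N ∷ b))) ⟩
  contains132 ((a₁ ++ u ∷ a₂) ++ N ∷ b) ≡⟨ avoids ⟩
  false                                ∎))
  where
  contains132-witness : ∀ a₀ → contains132 (a₀ ++ u ∷ a₂ ++ N ∷ b) ≡ true
  contains132-witness []       = ∨-trueˡ (contains132 (a₂ ++ N ∷ b)) (has32above-witness u a₂ N b w w∈ (ℕP.≰⇒> w≰u) (b<N w∈))
  contains132-witness (x ∷ a₀) = ∨-trueʳ (has32above x (a₀ ++ u ∷ a₂ ++ N ∷ b)) (contains132-witness a₀)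

-- Occurrences of 12-3-…-j

incAbove-++-below : ∀ k b xs ys → (∀ {z} → z ∈ ys → z < b) → incAbove k b (xs ++ ys) ≡ incAbove k b xs
incAbove-++-below zero    b xs       ys       ys<b = refl
incAbove-++-below (suc k) b []       []       ys<b = refl
incAbove-++-below (suc k) b []       (y ∷ ys) ys<b rewrite ≥⇒≮ᵇ {b} {y} (ℕP.<⇒≤ (ys<b (here refl))) =
  incAbove-++-below (suc k) b [] ys (λ m → ys<b (there m))
incAbove-++-below (suc k) b (x ∷ xs) ys ys<b with b <ᵇ x in b<x
... | true  = cong₂ _+_ (incAbove-++-below k x xs ys (λ m → ℕP.<-trans (ys<b m) (<ᵇ⇒< b<x)))
                        (incAbove-++-below (suc k) b xs ys ys<b)
... | false = incAbove-++-below (suc k) b xs ys ys<b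

incAbove-∷ʳ-max : ∀ i b r x → b < x → (∀ {z} → z ∈ r → z < x) →
                  incAbove (suc i) b (r ++ x ∷ []) ≡ incAbove (suc i) b r + incAbove i b r
incAbove-∷ʳ-max zero    b []      x b<x r<x rewrite <⇒<ᵇ b<x = refl
incAbove-∷ʳ-max (suc i) b []      x b<x r<x rewrite <⇒<ᵇ b<x = refl
incAbove-∷ʳ-max zero    b (y ∷ r) x b<x r<x with b <ᵇ y
... | true  = trans (cong (1 +_) (incAbove-∷ʳ-max zero b r x b<x (λ m → r<x (there m))))
                    (sym (ℕP.+-assoc 1 (incAbove 1 b r) 1))
... | false = incAbove-∷ʳ-max zero b r x b<x (λ m → r<x (there m))
incAbove-∷ʳ-max (suc i) b (y ∷ r) x b<x r<x with b <ᵇ y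
... | true  = trans (cong₂ _+_ (incAbove-∷ʳ-max i y r x (r<x (here refl)) (λ m → r<x (there m)))
                               (incAbove-∷ʳ-max (suc i) b r x b<x (λ m → r<x (there m))))
                    (+-interchange (incAbove (suc i) y r) (incAbove i y r) (incAbove (suc (suc i)) b r) (incAbove (suc i) b r))
... | false = incAbove-∷ʳ-max (suc i) b r x b<x (λ m → r<x (there m))

incAbove-shift : ∀ k c b r → incAbove k (c + b) (shift c r) ≡ incAbove k b r
incAbove-shift zero    c b r       = refl
incAbove-shift (suc k) c b []      = refl
incAbove-shift (suc k) c b (x ∷ r) rewrite +-<ᵇ-+ c b x | incAbove-shift k c x r | incAbove-shift (suc k) c b r = refl

incAbove-short : ∀ k b r → length r < k → incAbove k b r ≡ 0
incAbove-short (suc k) b []      _         = refl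
incAbove-short (suc k) b (x ∷ r) (s≤s r<k)
  rewrite incAbove-short k x r r<k | incAbove-short (suc k) b r (ℕP.m≤n⇒m≤1+n r<k) with b <ᵇ x
... | true  = refl
... | false = refl

occ-max-∷ : ∀ i x l → (∀ {z} → z ∈ l → z < x) → occ i (x ∷ l) ≡ occ i l
occ-max-∷ i x []      l<x = refl
occ-max-∷ i x (b ∷ r) l<x rewrite ≥⇒≮ᵇ {x} {b} (ℕP.<⇒≤ (l<x (here refl))) = refl

occ-++-above : ∀ i A B → (∀ {u w} → u ∈ A → w ∈ B → w < u) → occ i (A ++ B) ≡ occ i A + occ i B
occ-++-above i []           B B<A = refl
occ-++-above i (a ∷ [])     B B<A = occ-max-∷ i a B (B<A (here refl))
occ-++-above i (a ∷ a′ ∷ A) B B<A = begin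
  start (incAbove i a′ (A ++ B)) + occ i (a′ ∷ A ++ B)
    ≡⟨ cong₂ _+_ (cong start (incAbove-++-below i a′ A B (B<A (there (here refl)))))
                 (occ-++-above i (a′ ∷ A) B (λ u∈ w∈ → B<A (there u∈) w∈)) ⟩
  start (incAbove i a′ A) + (occ i (a′ ∷ A) + occ i B)
    ≡⟨ sym (ℕP.+-assoc (start (incAbove i a′ A)) (occ i (a′ ∷ A)) (occ i B)) ⟩
  start (incAbove i a′ A) + occ i (a′ ∷ A) + occ i B ∎
  where
  start : ℕ → ℕ
  start v = if a <ᵇ a′ then v else 0

occ-zero-∷ʳ-max : ∀ y r x → (∀ {z} → z ∈ y ∷ r → z < x) → occ 0 ((y ∷ r) ++ x ∷ []) ≡ occ 0 (y ∷ r) + 1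
occ-zero-∷ʳ-max y []      x l<x rewrite <⇒<ᵇ (l<x (here refl)) = refl
occ-zero-∷ʳ-max y (z ∷ r) x l<x =
  trans (cong ((if y <ᵇ z then 1 else 0) +_) (occ-zero-∷ʳ-max z r x (λ m → l<x (there m))))
        (sym (ℕP.+-assoc (if y <ᵇ z then 1 else 0) (occ 0 (z ∷ r)) 1))

occ-suc-∷ʳ-max : ∀ i r x → (∀ {z} → z ∈ r → z < x) → occ (suc i) (r ++ x ∷ []) ≡ occ (suc i) r + occ i r
occ-suc-∷ʳ-max i []          x r<x = refl
occ-suc-∷ʳ-max i (y ∷ [])    x r<x rewrite <⇒<ᵇ (r<x (here refl)) = refl
occ-suc-∷ʳ-max i (y ∷ z ∷ r) x r<x =
  trans (cong₂ _+_ (cong (λ v → if y <ᵇ z then v else 0)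
                         (incAbove-∷ʳ-max i z r x (r<x (there (here refl))) (λ m → r<x (there (there m)))))
                   (occ-suc-∷ʳ-max i (z ∷ r) x (λ m → r<x (there m))))
        (regroup (y <ᵇ z))
  where
  regroup : ∀ t → (if t then incAbove (suc i) z r + incAbove i z r else 0) + (occ (suc i) (z ∷ r) + occ i (z ∷ r))
                ≡ ((if t then incAbove (suc i) z r else 0) + occ (suc i) (z ∷ r))
                  + ((if t then incAbove i z r else 0) + occ i (z ∷ r))
  regroup true  = +-interchange (incAbove (suc i) z r) (incAbove i z r) (occ (suc i) (z ∷ r)) (occ i (z ∷ r))
  regroup false = refl

occ-shift : ∀ i c l → occ i (shift c l) ≡ occ i l
occ-shift i c []          = refl
occ-shift i c (a ∷ [])    = refl
occ-shift i c (a ∷ b ∷ r) = cong₂ _+_ first-pair (occ-shift i c (b ∷ r))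
  where
  first-pair : (if c + a <ᵇ c + b then incAbove i (c + b) (shift c r) else 0) ≡ (if a <ᵇ b then incAbove i b r else 0)
  first-pair rewrite +-<ᵇ-+ c a b | incAbove-shift i c b r = refl

occ-short : ∀ i l → length l ≤ i → occ i l ≡ 0
occ-short i []          _   = refl
occ-short i (a ∷ [])    _   = refl
occ-short i (a ∷ b ∷ r) l≤i = cong₂ _+_ first-pair (occ-short i (b ∷ r) (ℕP.<⇒≤ l≤i))
  where
  first-pair : (if a <ᵇ b then incAbove i b r else 0) ≡ 0
  first-pair rewrite incAbove-short i b r (ℕP.<-trans (ℕP.n<1+n (length r)) l≤i) with a <ᵇ b
  ... | true  = refl
  ... | false = refl

exponent-applyUpTo : ∀ (f : ℕ → ℕ) n i → exponent (applyUpTo f n) i ≡ (if i <ᵇ n then f i else 0)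
exponent-applyUpTo f zero    i       = refl
exponent-applyUpTo f (suc n) zero    = refl
exponent-applyUpTo f (suc n) (suc i) = exponent-applyUpTo (λ k → f (suc k)) n i

exponent-monoOf : ∀ σ i → exponent (monoOf σ) i ≡ occ i σ
exponent-monoOf σ i
  rewrite map-applyUpTo (λ k → k) (λ k → occ k σ) (length σ) | exponent-applyUpTo (λ k → occ k σ) (length σ) i
  with i <ᵇ length σ in i<?
... | true  = refl
... | false = sym (occ-short i σ (ℕP.≮⇒≥ (λ i< → true≢false (trans (sym (<⇒<ᵇ i<)) i<?))))

avoids132? : (π : List ℕ) → Dec (contains132 π ≡ false)
avoids132? π = contains132 π BoolP.≟ false

isDumont? : (π : List ℕ) → Dec (isDumont π ≡ true)
isDumont? π = isDumont π BoolP.≟ true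

∈-dumont132⁻ : ∀ m {σ} → σ ∈ dumont132 m → σ ∈ perms m × contains132 σ ≡ false × isDumont σ ≡ true
∈-dumont132⁻ m {σ} σ∈ with ∈-filter⁻ isDumont? {xs = filter avoids132? (perms m)} σ∈
... | σ∈′ , dumont with ∈-filter⁻ avoids132? {xs = perms m} σ∈′
... | σ∈perms , avoids = σ∈perms , avoids , dumont

∈-dumont132⁺ : ∀ m {σ} → σ ∈ perms m → contains132 σ ≡ false → isDumont σ ≡ true → σ ∈ dumont132 m
∈-dumont132⁺ m σ∈ avoids dumont =
  ∈-filter⁺ isDumont? (∈-filter⁺ avoids132? σ∈ avoids) dumont

dumont132-unique : ∀ m → Unique (dumont132 m)
dumont132-unique m =
  Unique.filter⁺ isDumont? (Unique.filter⁺ avoids132? (perms-unique m))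

dumont132-within : ∀ m {σ} → σ ∈ dumont132 m → Within m σ
dumont132-within m σ∈ = perms-within m (proj₁ (∈-dumont132⁻ m σ∈))

dumont132-length : ∀ m {σ} → σ ∈ dumont132 m → length σ ≡ m
dumont132-length m σ∈ = perms-length m (proj₁ (∈-dumont132⁻ m σ∈))

coeff-𝓑 : ∀ m e → coeff (𝓑 m) e ≡ sumBy (λ σ → δ e (monoOf σ)) (dumont132 m)
coeff-𝓑 m e = trans (coeff≡linExt-δ (𝓑 m) e) (linExt-unitTerms (δ e) monoOf (dumont132 m))

-- An odd maximum cannot be followed by a larger entry, so it comes last.
sumBy-dumont132-odd : ∀ n → even (suc n) ≡ false → ∀ (f : List ℕ → ℤ) →
                      sumBy f (dumont132 (suc n)) ≡ sumBy (λ ρ → f (ρ ++ suc n ∷ [])) (dumont132 n)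
sumBy-dumont132-odd n N-odd f = begin
  sumBy f (dumont132 (suc n))                     ≡⟨ sumBy-sameElements f (dumont132-unique (suc n)) appended-unique to from ⟩
  sumBy f (map append-max (dumont132 n))          ≡⟨ sumBy-map f append-max (dumont132 n) ⟩
  sumBy (λ ρ → f (ρ ++ suc n ∷ [])) (dumont132 n) ∎
  where
  append-max : List ℕ → List ℕ
  append-max ρ = ρ ++ suc n ∷ []
  appended-unique : Unique (map append-max (dumont132 n))
  appended-unique = Unique.map⁺ (λ {x} {y} → ∷ʳ-injectiveˡ x y) (dumont132-unique n)
  N-odd′ : odd (suc n) ≡ true
  N-odd′ = cong not N-odd
  to : ∀ {σ} → σ ∈ dumont132 (suc n) → σ ∈ map append-max (dumont132 n)
  to σ∈ with ∈-dumont132⁻ (suc n) σ∈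
  ... | σ∈perms , avoids , dumont with perms⁻ n σ∈perms
  ... | a , [] , refl , a∈′ = ∈-map⁺ append-max (∈-dumont132⁺ n a∈ (contains132-++⁻ˡ a (suc n ∷ []) avoids)
                                (trans (sym (isDumont-∷ʳ-max a (suc n) (within-< (perms-within n a∈)) N-odd′)) dumont))
    where
    a∈ : a ∈ perms n
    a∈ = subst (_∈ perms n) (++-identityʳ a) a∈′
  ... | a , y ∷ b , refl , ab∈ = ⊥-elim (true≢false (begin
    true                         ≡⟨ sym (isDumont-step a (suc n) y b dumont) ⟩
    dumontStep (suc n) y         ≡⟨ cong (λ t → if t then y <ᵇ suc n else suc n <ᵇ y) N-odd ⟩
    suc n <ᵇ y                   ≡⟨ ≥⇒≮ᵇ (ℕP.m≤n⇒m≤1+n (proj₂ (perms-within n ab∈ (∈-insert a)))) ⟩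
    false                        ∎))
  from : ∀ {σ} → σ ∈ map append-max (dumont132 n) → σ ∈ dumont132 (suc n)
  from σ∈ with ∈-map⁻ append-max σ∈
  ... | ρ , ρ∈ , refl with ∈-dumont132⁻ n ρ∈
  ... | ρ∈perms , avoids , dumont =
    ∈-dumont132⁺ (suc n) (perms⁺ n ρ [] (subst (_∈ perms n) (sym (++-identityʳ ρ)) ρ∈perms))
      (trans (contains132-∷ʳ-max ρ (suc n) ρ<N) avoids) (trans (isDumont-∷ʳ-max ρ (suc n) ρ<N N-odd′) dumont)
    where
    ρ<N : ∀ {z} → z ∈ ρ → z < suc n
    ρ<N = within-< (perms-within n ρ∈perms)

-- After an odd shift the entry 1 becomes even, but in a permutation of [1..K]
-- ending with K ≥ 2 it is followed by a larger entry.
odd-shift-not-dumont : ∀ k c τ rest → even c ≡ false → τ ++ suc (suc k) ∷ [] ∈ perms (suc (suc k)) →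
                       isDumont (shift c (τ ++ suc (suc k) ∷ []) ++ rest) ≡ true → ⊥
odd-shift-not-dumont k c τ rest c-odd σ∈ dumont with ∈-∃++ (1∈perms k (perms-∷ʳ⁻ (suc k) τ σ∈))
... | τ₁ , τ₂ , refl with ∷ʳ-nonempty τ₂ (suc (suc k))
... | y , rest′ , τ₂K≡ = ℕP.<-irrefl refl (ℕP.<-≤-trans (ℕP.+-cancelˡ-< c y 1 c+y<c+1) 1≤y)
  where
  K = suc (suc k)
  σ≡ : (τ₁ ++ 1 ∷ τ₂) ++ K ∷ [] ≡ τ₁ ++ 1 ∷ y ∷ rest′
  σ≡ = trans (++-assoc τ₁ (1 ∷ τ₂) (K ∷ [])) (cong (λ z → τ₁ ++ 1 ∷ z) τ₂K≡)
  1≤y : 1 ≤ y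
  1≤y = proj₁ (perms-within K σ∈ (subst (y ∈_) (sym σ≡) (∈-++⁺ʳ τ₁ (there (here refl)))))
  word≡ : shift c ((τ₁ ++ 1 ∷ τ₂) ++ K ∷ []) ++ rest ≡ shift c τ₁ ++ (c + 1) ∷ (c + y) ∷ (shift c rest′ ++ rest)
  word≡ = begin
    shift c ((τ₁ ++ 1 ∷ τ₂) ++ K ∷ []) ++ rest       ≡⟨ cong (λ l → shift c l ++ rest) σ≡ ⟩
    shift c (τ₁ ++ 1 ∷ y ∷ rest′) ++ rest            ≡⟨ cong (_++ rest) (map-++ (c +_) τ₁ (1 ∷ y ∷ rest′)) ⟩
    (shift c τ₁ ++ shift c (1 ∷ y ∷ rest′)) ++ rest  ≡⟨ ++-assoc (shift c τ₁) _ rest ⟩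
    shift c τ₁ ++ (c + 1) ∷ (c + y) ∷ (shift c rest′ ++ rest) ∎
  c+1-even : even (c + 1) ≡ true
  c+1-even = trans (cong even (ℕP.+-comm c 1)) (trans (even-suc c) (cong not c-odd))
  c+y<c+1 : c + y < c + 1
  c+y<c+1 = dumontStep-even c+1-even
    (isDumont-step (shift c τ₁) (c + 1) (c + y) (shift c rest′ ++ rest) (subst (λ l → isDumont l ≡ true) word≡ dumont))

x₂ : Mono
x₂ = 1 ∷ []

x₂x₃ : Mono
x₂x₃ = 1 ∷ 1 ∷ []

mulMono-congʳ : ∀ a b c → b ≋ c → mulMono a b ≋ mulMono a c
mulMono-congʳ a b c b≋c i = begin
  exponent (mulMono a b) i     ≡⟨ exponent-mulMono a b i ⟩
  exponent a i + exponent b i  ≡⟨ cong (exponent a i +_) (b≋c i) ⟩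
  exponent a i + exponent c i  ≡⟨ exponent-mulMono a c i ⟨
  exponent (mulMono a c) i     ∎

σ₁Mono-cong : ∀ a b → a ≋ b → σ₁Mono a ≋ σ₁Mono b
σ₁Mono-cong a b a≋b i = begin
  exponent (σ₁Mono a) i                    ≡⟨ exponent-mulMono a (0 ∷ a) i ⟩
  exponent a i + exponent (0 ∷ a) i        ≡⟨ cong₂ _+_ (a≋b i) (shifted i) ⟩
  exponent b i + exponent (0 ∷ b) i        ≡⟨ exponent-mulMono b (0 ∷ b) i ⟨
  exponent (σ₁Mono b) i                    ∎
  where
  shifted : ∀ i → exponent (0 ∷ a) i ≡ exponent (0 ∷ b) i
  shifted zero    = refl
  shifted (suc i) = a≋b i

monoOf-∷ʳ-max : ∀ y r x → (∀ {z} → z ∈ y ∷ r → z < x) →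
                monoOf ((y ∷ r) ++ x ∷ []) ≋ mulMono x₂ (σ₁Mono (monoOf (y ∷ r)))
monoOf-∷ʳ-max y r x ρ<x i = begin
  exponent (monoOf ((y ∷ r) ++ x ∷ [])) i                    ≡⟨ exponent-monoOf ((y ∷ r) ++ x ∷ []) i ⟩
  occ i ((y ∷ r) ++ x ∷ [])                                  ≡⟨ occ-append i ⟩
  exponent x₂ i + (exponent ρ i + exponent (0 ∷ ρ) i)        ≡⟨ cong (exponent x₂ i +_) (exponent-mulMono ρ (0 ∷ ρ) i) ⟨
  exponent x₂ i + exponent (σ₁Mono ρ) i                      ≡⟨ exponent-mulMono x₂ (σ₁Mono ρ) i ⟨
  exponent (mulMono x₂ (σ₁Mono ρ)) i                         ∎
  where
  ρ = monoOf (y ∷ r)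
  occ-append : ∀ i → occ i ((y ∷ r) ++ x ∷ []) ≡ exponent x₂ i + (exponent ρ i + exponent (0 ∷ ρ) i)
  occ-append zero = begin
    occ 0 ((y ∷ r) ++ x ∷ [])   ≡⟨ occ-zero-∷ʳ-max y r x ρ<x ⟩
    occ 0 (y ∷ r) + 1           ≡⟨ ℕP.+-comm (occ 0 (y ∷ r)) 1 ⟩
    1 + occ 0 (y ∷ r)           ≡⟨ cong (1 +_) (sym (trans (ℕP.+-identityʳ _) (exponent-monoOf (y ∷ r) 0))) ⟩
    1 + (exponent ρ 0 + 0)      ∎
  occ-append (suc i) = begin
    occ (suc i) ((y ∷ r) ++ x ∷ [])          ≡⟨ occ-suc-∷ʳ-max i (y ∷ r) x ρ<x ⟩
    occ (suc i) (y ∷ r) + occ i (y ∷ r)      ≡⟨ sym (cong₂ _+_ (exponent-monoOf (y ∷ r) (suc i)) (exponent-monoOf (y ∷ r) i)) ⟩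
    exponent ρ (suc i) + exponent ρ i        ∎

-- σ₁ ∘ σ₁ = σ₂ and σ₁ x₂ = x₂ x₃.
x₂σ₁-twice : ∀ m → mulMono x₂ (σ₁Mono (mulMono x₂ (σ₁Mono m))) ≋ mulMono x₂ (mulMono x₂x₃ (σ₂Mono m))
x₂σ₁-twice m i = begin
  exponent (mulMono x₂ (σ₁Mono X)) i
    ≡⟨ exponent-mulMono x₂ (σ₁Mono X) i ⟩
  exponent x₂ i + exponent (σ₁Mono X) i
    ≡⟨ cong (exponent x₂ i +_) (exponent-mulMono X (0 ∷ X) i) ⟩
  exponent x₂ i + (exponent X i + exponent (0 ∷ X) i)
    ≡⟨ cong (λ z → exponent x₂ i + (z + exponent (0 ∷ X) i)) (exponent-x₂σ₁ i) ⟩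
  exponent x₂ i + ((exponent x₂ i + (exponent m i + exponent (0 ∷ m) i)) + exponent (0 ∷ X) i)
    ≡⟨ cong (λ z → exponent x₂ i + ((exponent x₂ i + (exponent m i + exponent (0 ∷ m) i)) + z)) (exponent-0∷x₂σ₁ i) ⟩
  exponent x₂ i + ((exponent x₂ i + (exponent m i + exponent (0 ∷ m) i))
                   + (exponent (0 ∷ x₂) i + (exponent (0 ∷ m) i + exponent (0 ∷ 0 ∷ m) i)))
    ≡⟨ regroup i ⟩
  exponent x₂ i + (exponent x₂x₃ i + (exponent m i + (2 * exponent (0 ∷ m) i + exponent (0 ∷ 0 ∷ m) i)))
    ≡⟨ cong (λ z → exponent x₂ i + (exponent x₂x₃ i + z)) (exponent-σ₂Mono m i) ⟨
  exponent x₂ i + (exponent x₂x₃ i + exponent (σ₂Mono m) i)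
    ≡⟨ cong (exponent x₂ i +_) (exponent-mulMono x₂x₃ (σ₂Mono m) i) ⟨
  exponent x₂ i + exponent (mulMono x₂x₃ (σ₂Mono m)) i
    ≡⟨ exponent-mulMono x₂ (mulMono x₂x₃ (σ₂Mono m)) i ⟨
  exponent (mulMono x₂ (mulMono x₂x₃ (σ₂Mono m))) i ∎
  where
  X = mulMono x₂ (σ₁Mono m)
  exponent-x₂σ₁ : ∀ i → exponent X i ≡ exponent x₂ i + (exponent m i + exponent (0 ∷ m) i)
  exponent-x₂σ₁ i = trans (exponent-mulMono x₂ (σ₁Mono m) i) (cong (exponent x₂ i +_) (exponent-mulMono m (0 ∷ m) i))
  exponent-0∷x₂σ₁ : ∀ i → exponent (0 ∷ X) i ≡ exponent (0 ∷ x₂) i + (exponent (0 ∷ m) i + exponent (0 ∷ 0 ∷ m) i)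
  exponent-0∷x₂σ₁ zero    = refl
  exponent-0∷x₂σ₁ (suc i) = exponent-x₂σ₁ i
  regroup : ∀ i → exponent x₂ i + ((exponent x₂ i + (exponent m i + exponent (0 ∷ m) i))
                                   + (exponent (0 ∷ x₂) i + (exponent (0 ∷ m) i + exponent (0 ∷ 0 ∷ m) i)))
                ≡ exponent x₂ i + (exponent x₂x₃ i + (exponent m i + (2 * exponent (0 ∷ m) i + exponent (0 ∷ 0 ∷ m) i)))
  regroup zero          = solve 1 (λ a → con 1 :+ ((con 1 :+ (a :+ con 0)) :+ (con 0 :+ (con 0 :+ con 0)))
                                       := con 1 :+ (con 1 :+ (a :+ (con 2 :* con 0 :+ con 0)))) refl (exponent m 0)
  regroup (suc zero)    = solve 2 (λ a b → con 0 :+ ((con 0 :+ (b :+ a)) :+ (con 1 :+ (a :+ con 0)))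
                                         := con 0 :+ (con 1 :+ (b :+ (con 2 :* a :+ con 0)))) refl (exponent m 0) (exponent m 1)
  regroup (suc (suc i)) = solve 3 (λ a b c → con 0 :+ ((con 0 :+ (c :+ b)) :+ (con 0 :+ (b :+ a)))
                                           := con 0 :+ (con 0 :+ (c :+ (con 2 :* b :+ a)))) refl
                                  (exponent m i) (exponent m (suc i)) (exponent m (suc (suc i)))

blockWeight : ℕ → List ℕ → Mono
blockWeight (suc zero) τ = x₂
blockWeight k          τ = mulMono x₂ (mulMono x₂x₃ (σ₂Mono (monoOf τ)))

monoOf-block-max : ∀ k τ → even k ≡ false → τ ∈ dumont132 (k ∸ 1) →
                   monoOf ((τ ++ k ∷ []) ++ suc k ∷ []) ≋ blockWeight k τ
monoOf-block-max (suc zero) .[] _ (here refl) zero          = refl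
monoOf-block-max (suc zero) .[] _ (here refl) (suc zero)    = refl
monoOf-block-max (suc zero) .[] _ (here refl) (suc (suc i)) = refl
monoOf-block-max (suc (suc (suc j))) []      _ τ∈ with dumont132-length (suc (suc j)) τ∈
... | ()
monoOf-block-max (suc (suc (suc j))) (t ∷ τ) _ τ∈ i = begin
  exponent (monoOf ((t ∷ τ ++ K ∷ []) ++ suc K ∷ [])) i
    ≡⟨ monoOf-∷ʳ-max t (τ ++ K ∷ []) (suc K) τK<sucK i ⟩
  exponent (mulMono x₂ (σ₁Mono (monoOf (t ∷ τ ++ K ∷ [])))) i
    ≡⟨ append-inner i ⟩
  exponent (mulMono x₂ (σ₁Mono (mulMono x₂ (σ₁Mono (monoOf (t ∷ τ)))))) i
    ≡⟨ x₂σ₁-twice (monoOf (t ∷ τ)) i ⟩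
  exponent (mulMono x₂ (mulMono x₂x₃ (σ₂Mono (monoOf (t ∷ τ))))) i ∎
  where
  K = suc (suc (suc j))
  τ<K : ∀ {z} → z ∈ t ∷ τ → z < K
  τ<K = within-< (dumont132-within (suc (suc j)) τ∈)
  append-inner : mulMono x₂ (σ₁Mono (monoOf (t ∷ τ ++ K ∷ [])))
               ≋ mulMono x₂ (σ₁Mono (mulMono x₂ (σ₁Mono (monoOf (t ∷ τ)))))
  append-inner = mulMono-congʳ x₂ (σ₁Mono (monoOf (t ∷ τ ++ K ∷ []))) (σ₁Mono (mulMono x₂ (σ₁Mono (monoOf (t ∷ τ)))))
                   (σ₁Mono-cong (monoOf (t ∷ τ ++ K ∷ [])) (mulMono x₂ (σ₁Mono (monoOf (t ∷ τ))))
                                (monoOf-∷ʳ-max t τ K τ<K))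
  τK<sucK : ∀ {z} → z ∈ t ∷ τ ++ K ∷ [] → z < suc K
  τK<sucK z∈ with ∈-++⁻ (t ∷ τ) z∈
  ... | inj₁ z∈τ         = ℕP.m≤n⇒m≤1+n (τ<K z∈τ)
  ... | inj₂ (here refl) = ℕP.≤-refl

oddBlockSum : ℕ → (ℕ → List ℕ → List ℕ → ℤ) → ℕ → ℤ
oddBlockSum n w k = if even k then 0ℤ else sumBy (λ τ → sumBy (w k τ) (dumont132 (n ∸ k))) (dumont132 (k ∸ 1))

module EvenLength (n : ℕ) (n-odd : even n ≡ false) where

  N : ℕ
  N = suc n

  N-even : even N ≡ true
  N-even = even-suc-flip n n-odd

  block : ℕ → List ℕ → List ℕ
  block k τ = shift (n ∸ k) (τ ++ k ∷ [])

  glue : ℕ → List ℕ → List ℕ → List ℕ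
  glue k τ β = block k τ ++ N ∷ β

  glued : ℕ → List (List ℕ)
  glued k = concatMap (λ τ → map (glue k τ) (dumont132 (n ∸ k))) (dumont132 (k ∸ 1))

  gluedIfOdd : ℕ → List (List ℕ)
  gluedIfOdd k = if even k then [] else glued k

  decomposition : List (List ℕ)
  decomposition = map (N ∷_) (dumont132 n) ++ concatMap gluedIfOdd (upTo n)

  block-within : ∀ k τ → k ≤ n → even k ≡ false → τ ∈ dumont132 (k ∸ 1) →
                 ∀ {u} → u ∈ block k τ → n ∸ k < u × u ≤ n
  block-within k τ k≤n k-odd τ∈ u∈ with ∈-map⁻ (n ∸ k +_) u∈
  ... | t , t∈ , refl = ℕP.≤-trans (ℕP.≤-reflexive (ℕP.+-comm 1 (n ∸ k))) (ℕP.+-monoʳ-≤ (n ∸ k) (proj₁ t-range))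
                      , ℕP.≤-trans (ℕP.+-monoʳ-≤ (n ∸ k) (proj₂ t-range)) (ℕP.≤-reflexive (ℕP.m∸n+n≡m k≤n))
    where
    t-range : 1 ≤ t × t ≤ k
    t-range with ∈-++⁻ τ t∈
    ... | inj₁ t∈τ       = let 1≤t , t≤k-1 = dumont132-within (k ∸ 1) τ∈ t∈τ in 1≤t , ℕP.≤-trans t≤k-1 (ℕP.m∸n≤m k 1)
    ... | inj₂ (here refl) = odd⇒≥1 k-odd , ℕP.≤-refl

  N∉block : ∀ k τ → k ≤ n → even k ≡ false → τ ∈ dumont132 (k ∸ 1) → N ∉ block k τ
  N∉block k τ k≤n k-odd τ∈ N∈ = ℕP.<-irrefl refl (proj₂ (block-within k τ k≤n k-odd τ∈ N∈))

  length-block : ∀ k τ → even k ≡ false → τ ∈ dumont132 (k ∸ 1) → length (block k τ) ≡ k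
  length-block k τ k-odd τ∈ = begin
    length (block k τ)        ≡⟨ length-shift (n ∸ k) (τ ++ k ∷ []) ⟩
    length (τ ++ k ∷ [])      ≡⟨ length-++ τ ⟩
    length τ + 1              ≡⟨ cong (_+ 1) (dumont132-length (k ∸ 1) τ∈) ⟩
    k ∸ 1 + 1                 ≡⟨ ℕP.m∸n+n≡m (odd⇒≥1 k-odd) ⟩
    k                         ∎

  ∈-gluedIfOdd⁻ : ∀ k {π} → π ∈ gluedIfOdd k → even k ≡ false ×
                  ∃₂ λ τ β → τ ∈ dumont132 (k ∸ 1) × β ∈ dumont132 (n ∸ k) × π ≡ glue k τ β
  ∈-gluedIfOdd⁻ k π∈ with even k in k-parity
  ... | false with find (∈-concatMap⁻ (λ τ → map (glue k τ) (dumont132 (n ∸ k))) π∈)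
  ... | τ , τ∈ , π∈′ with ∈-map⁻ (glue k τ) π∈′
  ... | β , β∈ , refl = refl , τ , β , τ∈ , β∈ , refl

  glue-injective : ∀ {k τ β k′ τ′ β′} → k ≤ n → even k ≡ false → τ ∈ dumont132 (k ∸ 1) →
                   k′ ≤ n → even k′ ≡ false → τ′ ∈ dumont132 (k′ ∸ 1) →
                   glue k τ β ≡ glue k′ τ′ β′ → block k τ ≡ block k′ τ′ × β ≡ β′
  glue-injective {k} {τ} {β} {k′} {τ′} {β′} k≤n k-odd τ∈ k′≤n k′-odd τ′∈ =
    ++-∷-cancel N (block k τ) β (block k′ τ′) β′ (N∉block k τ k≤n k-odd τ∈) (N∉block k′ τ′ k′≤n k′-odd τ′∈)

  glued-unique : ∀ k → k ≤ n → even k ≡ false → Unique (glued k)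
  glued-unique k k≤n k-odd =
    Unique-concatMap⁺ (λ τ → map (glue k τ) (dumont132 (n ∸ k))) (dumont132-unique (k ∸ 1))
      (λ {τ} _ → Unique.map⁺ (λ {x} {y} eq → proj₂ (∷-injective (++-cancelˡ (block k τ) (N ∷ x) (N ∷ y) eq)))
                              (dumont132-unique (n ∸ k)))
      disjoint
    where
    disjoint : ∀ {τ τ′ π} → τ ∈ dumont132 (k ∸ 1) → τ′ ∈ dumont132 (k ∸ 1) →
               π ∈ map (glue k τ) (dumont132 (n ∸ k)) → π ∈ map (glue k τ′) (dumont132 (n ∸ k)) → τ ≡ τ′
    disjoint {τ} {τ′} τ∈ τ′∈ π∈ π∈′ with ∈-map⁻ (glue k τ) π∈ | ∈-map⁻ (glue k τ′) π∈′
    ... | β , _ , refl | β′ , _ , eq with glue-injective k≤n k-odd τ∈ k≤n k-odd τ′∈ eq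
    ... | same-block , _ = ∷ʳ-injectiveˡ τ τ′ (shift-injective (n ∸ k) same-block)

  decomposition-unique : Unique decomposition
  decomposition-unique =
    Unique.++⁺ (Unique.map⁺ (λ eq → proj₂ (∷-injective eq)) (dumont132-unique n))
               (Unique-concatMap⁺ gluedIfOdd (Unique.upTo⁺ n) glued-if-odd-unique different-k)
               N-first-or-not
    where
    glued-if-odd-unique : ∀ {k} → k ∈ upTo n → Unique (gluedIfOdd k)
    glued-if-odd-unique {k} k∈ with even k in k-parity
    ... | true  = []
    ... | false = glued-unique k (ℕP.<⇒≤ (∈-upTo⁻ k∈)) k-parity
    different-k : ∀ {k k′ π} → k ∈ upTo n → k′ ∈ upTo n → π ∈ gluedIfOdd k → π ∈ gluedIfOdd k′ → k ≡ k′
    different-k {k} {k′} k∈ k′∈ π∈ π∈′ with ∈-gluedIfOdd⁻ k π∈ | ∈-gluedIfOdd⁻ k′ π∈′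
    ... | k-odd , τ , β , τ∈ , _ , refl | k′-odd , τ′ , β′ , τ′∈ , _ , eq
      with glue-injective (ℕP.<⇒≤ (∈-upTo⁻ k∈)) k-odd τ∈ (ℕP.<⇒≤ (∈-upTo⁻ k′∈)) k′-odd τ′∈ eq
    ... | same-block , _ = begin
      k                    ≡⟨ length-block k τ k-odd τ∈ ⟨
      length (block k τ)   ≡⟨ cong length same-block ⟩
      length (block k′ τ′) ≡⟨ length-block k′ τ′ k′-odd τ′∈ ⟩
      k′                   ∎
    N-first-or-not : ∀ {π} → ¬ (π ∈ map (N ∷_) (dumont132 n) × π ∈ concatMap gluedIfOdd (upTo n))
    N-first-or-not (π∈ , π∈′) with ∈-map⁻ (N ∷_) π∈ | find (∈-concatMap⁻ gluedIfOdd {xs = upTo n} π∈′)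
    ... | β , _ , refl | k , k∈ , π∈k with ∈-gluedIfOdd⁻ k π∈k
    ... | k-odd , τ , β′ , τ∈ , _ , eq
      with ++-∷-cancel N [] β (block k τ) β′ (λ ()) (N∉block k τ (ℕP.<⇒≤ (∈-upTo⁻ k∈)) k-odd τ∈) eq
    ... | empty-block , _ =
      true≢false (subst (λ m → even m ≡ false) (trans (sym (length-block k τ k-odd τ∈)) (cong length (sym empty-block))) k-odd)

  N∷∈ : ∀ {β} → β ∈ dumont132 n → N ∷ β ∈ dumont132 N
  N∷∈ {β} β∈ with ∈-dumont132⁻ n β∈
  ... | β∈perms , avoids , dumont =
    ∈-dumont132⁺ N (perms⁺ n [] β β∈perms) (trans (contains132-max-∷ N β β<N) avoids)
      (isDumont-max-∷ N β N-even β<N nonempty dumont)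
    where
    β<N = within-< (perms-within n β∈perms)
    nonempty : 1 ≤ length β
    nonempty = subst (1 ≤_) (sym (perms-length n β∈perms)) (odd⇒≥1 n-odd)

  block-entries-< : ∀ {k τ} → even k ≡ false → τ ∈ dumont132 (k ∸ 1) → ∀ {z} → z ∈ τ → z < k
  block-entries-< {k} k-odd τ∈ = perms-pred-< k (odd⇒≥1 k-odd) (proj₁ (∈-dumont132⁻ (k ∸ 1) τ∈))

  below-block-N : ∀ {k τ β} → k ≤ n → even k ≡ false → τ ∈ dumont132 (k ∸ 1) → β ∈ dumont132 (n ∸ k) →
                  ∀ {u w} → u ∈ block k τ ++ N ∷ [] → w ∈ β → w < u
  below-block-N {k} {τ} k≤n k-odd τ∈ β∈ u∈ w∈ with ∈-++⁻ (block k τ) u∈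
  ... | inj₁ u∈block   = ℕP.≤-<-trans (proj₂ (dumont132-within (n ∸ k) β∈ w∈)) (proj₁ (block-within k τ k≤n k-odd τ∈ u∈block))
  ... | inj₂ (here refl) = s≤s (ℕP.≤-trans (proj₂ (dumont132-within (n ∸ k) β∈ w∈)) (ℕP.m∸n≤m n k))

  glue∈perms : ∀ {k τ β} → k < n → even k ≡ false → τ ∈ perms (k ∸ 1) → β ∈ perms (n ∸ k) → glue k τ β ∈ perms N
  glue∈perms {k} {τ} {β} k<n k-odd τ∈ β∈ =
    perms⁺ n (block k τ) β (subst (λ m → block k τ ++ β ∈ perms m) k+c≡n
                                  (perms-join k (n ∸ k) (τ ++ k ∷ []) β (∷ʳ-odd∈perms k τ k-odd τ∈) β∈))
    where
    k+c≡n : k + (n ∸ k) ≡ n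
    k+c≡n = trans (ℕP.+-comm k (n ∸ k)) (ℕP.m∸n+n≡m (ℕP.<⇒≤ k<n))

  glue-avoids132 : ∀ {k τ β} → k ≤ n → even k ≡ false → τ ∈ dumont132 (k ∸ 1) → β ∈ dumont132 (n ∸ k) →
                   contains132 (glue k τ β) ≡ false
  glue-avoids132 {k} {τ} {β} k≤n k-odd τ∈ β∈ = begin
    contains132 (block k τ ++ N ∷ β)          ≡⟨ cong contains132 (sym (++-assoc (block k τ) (N ∷ []) β)) ⟩
    contains132 ((block k τ ++ N ∷ []) ++ β)  ≡⟨ contains132-++-above (block k τ ++ N ∷ []) β (below-block-N k≤n k-odd τ∈ β∈)
                                                   block-N-avoids (proj₁ (proj₂ (∈-dumont132⁻ (n ∸ k) β∈))) ⟩
    false                                     ∎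
    where
    block-N-avoids : contains132 (block k τ ++ N ∷ []) ≡ false
    block-N-avoids = begin
      contains132 (block k τ ++ N ∷ [])
        ≡⟨ contains132-∷ʳ-max (block k τ) N (λ m → s≤s (proj₂ (block-within k τ k≤n k-odd τ∈ m))) ⟩
      contains132 (block k τ)            ≡⟨ contains132-shift (n ∸ k) (τ ++ k ∷ []) ⟩
      contains132 (τ ++ k ∷ [])          ≡⟨ contains132-∷ʳ-max τ k (block-entries-< k-odd τ∈) ⟩
      contains132 τ                      ≡⟨ proj₁ (proj₂ (∈-dumont132⁻ (k ∸ 1) τ∈)) ⟩
      false                              ∎

  glue-isDumont : ∀ {k τ β} → k < n → even k ≡ false → τ ∈ dumont132 (k ∸ 1) → β ∈ dumont132 (n ∸ k) →
                  isDumont (glue k τ β) ≡ true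
  glue-isDumont {k} {τ} {β} k<n k-odd τ∈ β∈ = begin
    isDumont (block k τ ++ N ∷ β)                     ≡⟨ cong (λ l → isDumont (l ++ N ∷ β)) block≡ ⟩
    isDumont ((shift c τ ++ (c + k) ∷ []) ++ N ∷ β)   ≡⟨ cong isDumont (++-assoc (shift c τ) ((c + k) ∷ []) (N ∷ β)) ⟩
    isDumont (shift c τ ++ (c + k) ∷ N ∷ β)           ≡⟨ isDumont-join (shift c τ) (c + k) N β block-dumont n-then-N N∷β-dumont ⟩
    true                                              ∎
    where
    c = n ∸ k
    k≤n = ℕP.<⇒≤ k<n
    block≡ : block k τ ≡ shift c τ ++ (c + k) ∷ []
    block≡ = map-++ (c +_) τ (k ∷ [])
    block-dumont : isDumont (shift c τ ++ (c + k) ∷ []) ≡ true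
    block-dumont = begin
      isDumont (shift c τ ++ (c + k) ∷ [])  ≡⟨ cong isDumont (sym block≡) ⟩
      isDumont (block k τ)                  ≡⟨ isDumont-shift c (τ ++ k ∷ []) (odd∸odd-even n k k≤n n-odd k-odd) ⟩
      isDumont (τ ++ k ∷ [])                ≡⟨ isDumont-∷ʳ-max τ k (block-entries-< k-odd τ∈) (cong not k-odd) ⟩
      isDumont τ                            ≡⟨ proj₂ (proj₂ (∈-dumont132⁻ (k ∸ 1) τ∈)) ⟩
      true                                  ∎
    n-then-N : dumontStep (c + k) N ≡ true
    n-then-N rewrite ℕP.m∸n+n≡m k≤n | n-odd = <⇒<ᵇ (ℕP.n<1+n n)
    β-nonempty : 1 ≤ length β
    β-nonempty = subst (1 ≤_) (sym (dumont132-length c β∈)) (ℕP.m<n⇒0<n∸m k<n)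
    N∷β-dumont : isDumont (N ∷ β) ≡ true
    N∷β-dumont = isDumont-max-∷ N β N-even (λ w∈ → s≤s (ℕP.≤-trans (proj₂ (dumont132-within c β∈ w∈)) (ℕP.m∸n≤m n k)))
                                β-nonempty (proj₂ (proj₂ (∈-dumont132⁻ c β∈)))

  glue∈ : ∀ {k τ β} → k < n → even k ≡ false → τ ∈ dumont132 (k ∸ 1) → β ∈ dumont132 (n ∸ k) →
          glue k τ β ∈ dumont132 N
  glue∈ {k} k<n k-odd τ∈ β∈ =
    ∈-dumont132⁺ N (glue∈perms k<n k-odd (proj₁ (∈-dumont132⁻ (k ∸ 1) τ∈)) (proj₁ (∈-dumont132⁻ (n ∸ k) β∈)))
      (glue-avoids132 (ℕP.<⇒≤ k<n) k-odd τ∈ β∈) (glue-isDumont k<n k-odd τ∈ β∈)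

  decomposition⊆ : ∀ {π} → π ∈ decomposition → π ∈ dumont132 N
  decomposition⊆ π∈ with ∈-++⁻ (map (N ∷_) (dumont132 n)) π∈
  ... | inj₁ π∈₁ with ∈-map⁻ (N ∷_) π∈₁
  ... | β , β∈ , refl = N∷∈ β∈
  decomposition⊆ π∈ | inj₂ π∈₂ with find (∈-concatMap⁻ gluedIfOdd {xs = upTo n} π∈₂)
  ... | k , k∈ , π∈k with ∈-gluedIfOdd⁻ k π∈k
  ... | k-odd , τ , β , τ∈ , β∈ , refl = glue∈ (∈-upTo⁻ k∈) k-odd τ∈ β∈

  n-before-N : ∀ A B → A ++ B ∈ perms n → isDumont (A ++ N ∷ B) ≡ true → n ∈ A → ∃ λ p → A ≡ p ++ n ∷ []
  n-before-N A B AB∈ dumont n∈A with ∈-∃++ n∈A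
  ... | p , []    , refl = p , refl
  ... | p , y ∷ q , refl = ⊥-elim (ℕP.<-irrefl refl (ℕP.<-≤-trans n<y y≤n))
    where
    n<y : n < y
    n<y = dumontStep-odd n-odd
      (isDumont-step p n y (q ++ N ∷ B) (subst (λ l → isDumont l ≡ true) (++-assoc p (n ∷ y ∷ q) (N ∷ B)) dumont))
    y≤n : y ≤ n
    y≤n = proj₂ (perms-within n AB∈ (∈-++⁺ˡ (∈-++⁺ʳ p (there (here refl)))))

  n∈upper-block : ∀ A B {τ₀} → A ++ B ∈ perms n → 1 ≤ length A → τ₀ ∈ perms (length A) →
                  A ≡ shift (length B) τ₀ → n ∈ A
  n∈upper-block (a ∷ A′) B AB∈ _ τ₀∈ A≡ =
    subst (n ∈_) (sym A≡) (subst (_∈ shift (length B) _) c+k≡n (∈-map⁺ (length B +_) (max∈perms (length A′) τ₀∈)))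
    where
    c+k≡n : length B + length (a ∷ A′) ≡ n
    c+k≡n = trans (ℕP.+-comm (length B) _) (trans (sym (length-++ (a ∷ A′))) (perms-length n AB∈))

  block-shape : ∀ A B → 1 ≤ length A → A ++ B ∈ perms n →
                contains132 (A ++ N ∷ B) ≡ false → isDumont (A ++ N ∷ B) ≡ true →
                B ∈ perms (length B) ×
                ∃ λ τ → τ ++ length A ∷ [] ∈ perms (length A) × A ≡ shift (length B) (τ ++ length A ∷ [])
  block-shape A B A-nonempty AB∈ avoids dumont
    with perms-split n A B AB∈ (avoids132-split A N B avoids (λ w∈ → within-< (perms-within n AB∈) (∈-++⁺ʳ A w∈)))
  ... | B∈ , τ₀ , τ₀∈ , A≡ with n-before-N A B AB∈ dumont (n∈upper-block A B AB∈ A-nonempty τ₀∈ A≡)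
  ... | p , A≡p∷ʳn with shift-≡-∷ʳ (length B) τ₀ p n (trans (sym A≡) A≡p∷ʳn)
  ... | τ , t , refl , c+t≡n =
    B∈ , τ , subst (λ z → τ ++ z ∷ [] ∈ perms (length A)) t≡k τ₀∈
       , trans A≡ (cong (λ z → shift (length B) (τ ++ z ∷ [])) t≡k)
    where
    t≡k : t ≡ length A
    t≡k = ℕP.+-cancelˡ-≡ (length B) t (length A) (begin
      length B + t             ≡⟨ c+t≡n ⟩
      n                        ≡⟨ perms-length n AB∈ ⟨
      length (A ++ B)          ≡⟨ length-++ A ⟩
      length A + length B      ≡⟨ ℕP.+-comm (length A) (length B) ⟩
      length B + length A      ∎)

  block-odd : ∀ k c τ rest → 1 ≤ k → k + c ≡ n → τ ++ k ∷ [] ∈ perms k →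
              isDumont (shift c (τ ++ k ∷ []) ++ rest) ≡ true → even k ≡ false
  block-odd (suc zero)    c τ rest _ _     _  _      = refl
  block-odd (suc (suc k)) c τ rest _ K+c≡n σ∈ dumont with even k in k-parity
  ... | false = refl
  ... | true  = ⊥-elim (odd-shift-not-dumont k c τ rest c-odd σ∈ dumont)
    where
    c-odd : even c ≡ false
    c-odd = begin
      even c                   ≡⟨ even-+ (suc (suc k)) c k-parity ⟨
      even (suc (suc k) + c)   ≡⟨ cong even K+c≡n ⟩
      even n                   ≡⟨ n-odd ⟩
      false                    ∎

  block-τ∈ : ∀ k c τ B → even k ≡ false → k + c ≡ n → τ ++ k ∷ [] ∈ perms k →
             contains132 (shift c (τ ++ k ∷ []) ++ N ∷ B) ≡ false → isDumont (shift c (τ ++ k ∷ []) ++ N ∷ B) ≡ true →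
             τ ∈ dumont132 (k ∸ 1)
  block-τ∈ (suc k) c τ B k-odd k+c≡n σ∈ avoids dumont = ∈-dumont132⁺ k τ∈perms τ-avoids τ-dumont
    where
    τ∈perms : τ ∈ perms k
    τ∈perms = perms-∷ʳ⁻ k τ σ∈
    c-even : even c ≡ true
    c-even = trans (cong even (trans (sym (ℕP.m+n∸m≡n (suc k) c)) (cong (_∸ suc k) k+c≡n)))
                   (odd∸odd-even n (suc k) (subst (suc k ≤_) k+c≡n (ℕP.m≤m+n (suc k) c)) n-odd k-odd)
    τ-avoids : contains132 τ ≡ false
    τ-avoids = contains132-++⁻ˡ τ (suc k ∷ [])
      (trans (sym (contains132-shift c (τ ++ suc k ∷ []))) (contains132-++⁻ˡ (shift c (τ ++ suc k ∷ [])) (N ∷ B) avoids))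
    block≡ : shift c τ ++ n ∷ [] ≡ shift c (τ ++ suc k ∷ [])
    block≡ = trans (cong (λ z → shift c τ ++ z ∷ []) (trans (sym k+c≡n) (ℕP.+-comm (suc k) c)))
                   (sym (map-++ (c +_) τ (suc k ∷ [])))
    τ-dumont : isDumont τ ≡ true
    τ-dumont = begin
      isDumont τ                          ≡⟨ isDumont-∷ʳ-max τ (suc k) (within-< (perms-within k τ∈perms)) (cong not k-odd) ⟨
      isDumont (τ ++ suc k ∷ [])          ≡⟨ isDumont-shift c (τ ++ suc k ∷ []) c-even ⟨
      isDumont (shift c (τ ++ suc k ∷ [])) ≡⟨ cong isDumont block≡ ⟨
      isDumont (shift c τ ++ n ∷ [])      ≡⟨ isDumont-cut (shift c τ) n (N ∷ B) cut-at-n (cong not n-odd) ⟩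
      true                                ∎
      where
      cut-at-n : isDumont (shift c τ ++ n ∷ N ∷ B) ≡ true
      cut-at-n = subst (λ l → isDumont l ≡ true)
        (trans (cong (_++ N ∷ B) (sym block≡)) (++-assoc (shift c τ) (n ∷ []) (N ∷ B))) dumont

  glued⊇ : ∀ A B → 1 ≤ length A → 1 ≤ length B → A ++ B ∈ perms n →
           contains132 (A ++ N ∷ B) ≡ false → isDumont (A ++ N ∷ B) ≡ true →
           A ++ N ∷ B ∈ concatMap gluedIfOdd (upTo n)
  glued⊇ A B A-nonempty B-nonempty AB∈ avoids dumont with block-shape A B A-nonempty AB∈ avoids dumont
  ... | B∈perms , τ , σ∈ , A≡ = ∈-concatMap⁺ gluedIfOdd (lose (∈-upTo⁺ k<n) π∈gluedIfOdd)
    where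
    k = length A
    c = length B
    k+c≡n : k + c ≡ n
    k+c≡n = trans (sym (length-++ A)) (perms-length n AB∈)
    c≡n∸k : c ≡ n ∸ k
    c≡n∸k = trans (sym (ℕP.m+n∸m≡n k c)) (cong (_∸ k) k+c≡n)
    k<n : k < n
    k<n = subst (k <_) k+c≡n (ℕP.m<m+n k B-nonempty)
    dumont′ = subst (λ l → isDumont (l ++ N ∷ B) ≡ true) A≡ dumont
    k-odd : even k ≡ false
    k-odd = block-odd k c τ (N ∷ B) A-nonempty k+c≡n σ∈ dumont′
    τ∈ : τ ∈ dumont132 (k ∸ 1)
    τ∈ = block-τ∈ k c τ B k-odd k+c≡n σ∈ (subst (λ l → contains132 (l ++ N ∷ B) ≡ false) A≡ avoids) dumont′
    B∈ : B ∈ dumont132 (n ∸ k)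
    B∈ = ∈-dumont132⁺ (n ∸ k) (subst (λ m → B ∈ perms m) c≡n∸k B∈perms)
           (contains132-++⁻ʳ (N ∷ []) B (contains132-++⁻ʳ A (N ∷ B) avoids)) (isDumont-tail N B (isDumont-++⁻ʳ A (N ∷ B) dumont))
    π≡ : A ++ N ∷ B ≡ glue k τ B
    π≡ = cong (_++ N ∷ B) (trans A≡ (cong (λ m → shift m (τ ++ k ∷ [])) c≡n∸k))
    π∈gluedIfOdd : A ++ N ∷ B ∈ gluedIfOdd k
    π∈gluedIfOdd = subst (λ t → A ++ N ∷ B ∈ (if t then [] else glued k)) (sym k-odd)
      (∈-concatMap⁺ (λ τ → map (glue k τ) (dumont132 (n ∸ k)))
        (lose τ∈ (subst (_∈ map (glue k τ) (dumont132 (n ∸ k))) (sym π≡) (∈-map⁺ (glue k τ) B∈))))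

  decomposition⊇ : ∀ {π} → π ∈ dumont132 N → π ∈ decomposition
  decomposition⊇ π∈ with ∈-dumont132⁻ N π∈
  ... | π∈perms , avoids , dumont with perms⁻ n π∈perms
  ... | a       , []    , refl , _   = ⊥-elim (true≢false (trans (sym (isDumont-last a N dumont)) (cong not N-even)))
  ... | []      , y ∷ b , refl , ab∈ =
    ∈-++⁺ˡ (∈-map⁺ (N ∷_) (∈-dumont132⁺ n ab∈ (contains132-++⁻ʳ (N ∷ []) (y ∷ b) avoids) (isDumont-tail N (y ∷ b) dumont)))
  ... | u ∷ a   , y ∷ b , refl , ab∈ =
    ∈-++⁺ʳ (map (N ∷_) (dumont132 n)) (glued⊇ (u ∷ a) (y ∷ b) (s≤s z≤n) (s≤s z≤n) ab∈ avoids dumont)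

  sumBy-dumont132-even : ∀ (f : List ℕ → ℤ) →
    sumBy f (dumont132 N) ≡ sumBy (λ β → f (N ∷ β)) (dumont132 n) +ℤ sumBy (oddBlockSum n (λ k τ β → f (glue k τ β))) (upTo n)
  sumBy-dumont132-even f = begin
    sumBy f (dumont132 N)
      ≡⟨ sumBy-sameElements f (dumont132-unique N) decomposition-unique decomposition⊇ decomposition⊆ ⟩
    sumBy f decomposition
      ≡⟨ sumBy-++ f (map (N ∷_) (dumont132 n)) _ ⟩
    sumBy f (map (N ∷_) (dumont132 n)) +ℤ sumBy f (concatMap gluedIfOdd (upTo n))
      ≡⟨ cong₂ _+ℤ_ (sumBy-map f (N ∷_) (dumont132 n)) (sumBy-concatMap f gluedIfOdd (upTo n)) ⟩
    sumBy (λ β → f (N ∷ β)) (dumont132 n) +ℤ sumBy (λ k → sumBy f (gluedIfOdd k)) (upTo n)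
      ≡⟨ cong (sumBy (λ β → f (N ∷ β)) (dumont132 n) +ℤ_) (sumBy-cong per-k (upTo n)) ⟩
    sumBy (λ β → f (N ∷ β)) (dumont132 n) +ℤ sumBy (oddBlockSum n (λ k τ β → f (glue k τ β))) (upTo n) ∎
    where
    per-k : ∀ k → sumBy f (gluedIfOdd k) ≡ oddBlockSum n (λ k τ β → f (glue k τ β)) k
    per-k k with even k
    ... | true  = refl
    ... | false = trans (sumBy-concatMap f _ (dumont132 (k ∸ 1)))
                        (sumBy-cong (λ τ → sumBy-map f (glue k τ) (dumont132 (n ∸ k))) (dumont132 (k ∸ 1)))

  monoOf-N∷ : ∀ {β} → β ∈ dumont132 n → monoOf (N ∷ β) ≋ monoOf β
  monoOf-N∷ {β} β∈ i = begin
    exponent (monoOf (N ∷ β)) i   ≡⟨ exponent-monoOf (N ∷ β) i ⟩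
    occ i (N ∷ β)                 ≡⟨ occ-max-∷ i N β (within-< (dumont132-within n β∈)) ⟩
    occ i β                       ≡⟨ exponent-monoOf β i ⟨
    exponent (monoOf β) i         ∎

  monoOf-glue : ∀ {k τ β} → k < n → even k ≡ false → τ ∈ dumont132 (k ∸ 1) → β ∈ dumont132 (n ∸ k) →
                monoOf (glue k τ β) ≋ mulMono (blockWeight k τ) (monoOf β)
  monoOf-glue {k} {τ} {β} k<n k-odd τ∈ β∈ i = begin
    exponent (monoOf (glue k τ β)) i
      ≡⟨ exponent-monoOf (glue k τ β) i ⟩
    occ i (block k τ ++ N ∷ β)
      ≡⟨ cong (occ i) (sym (++-assoc (block k τ) (N ∷ []) β)) ⟩
    occ i ((block k τ ++ N ∷ []) ++ β)
      ≡⟨ occ-++-above i (block k τ ++ N ∷ []) β (below-block-N (ℕP.<⇒≤ k<n) k-odd τ∈ β∈) ⟩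
    occ i (block k τ ++ N ∷ []) + occ i β
      ≡⟨ cong (λ l → occ i l + occ i β) block-N≡ ⟩
    occ i (shift c ((τ ++ k ∷ []) ++ suc k ∷ [])) + occ i β
      ≡⟨ cong (_+ occ i β) (occ-shift i c ((τ ++ k ∷ []) ++ suc k ∷ [])) ⟩
    occ i ((τ ++ k ∷ []) ++ suc k ∷ []) + occ i β
      ≡⟨ cong₂ _+_ (exponent-monoOf ((τ ++ k ∷ []) ++ suc k ∷ []) i) (exponent-monoOf β i) ⟨
    exponent (monoOf ((τ ++ k ∷ []) ++ suc k ∷ [])) i + exponent (monoOf β) i
      ≡⟨ cong (_+ exponent (monoOf β) i) (monoOf-block-max k τ k-odd τ∈ i) ⟩
    exponent (blockWeight k τ) i + exponent (monoOf β) i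
      ≡⟨ exponent-mulMono (blockWeight k τ) (monoOf β) i ⟨
    exponent (mulMono (blockWeight k τ) (monoOf β)) i ∎
    where
    c = n ∸ k
    block-N≡ : block k τ ++ N ∷ [] ≡ shift c ((τ ++ k ∷ []) ++ suc k ∷ [])
    block-N≡ = begin
      block k τ ++ N ∷ []                       ≡⟨ cong (λ z → block k τ ++ z ∷ []) (cong suc (ℕP.m∸n+n≡m (ℕP.<⇒≤ k<n))) ⟨
      block k τ ++ suc (c + k) ∷ []             ≡⟨ cong (λ z → block k τ ++ z ∷ []) (ℕP.+-suc c k) ⟨
      block k τ ++ (c + suc k) ∷ []             ≡⟨ map-++ (c +_) (τ ++ k ∷ []) (suc k ∷ []) ⟨
      shift c ((τ ++ k ∷ []) ++ suc k ∷ [])     ∎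

  coeff-𝓑-even : ∀ e →
    coeff (𝓑 N) e ≡ coeff (𝓑 n) e +ℤ sumBy (oddBlockSum n (λ k τ β → δ e (mulMono (blockWeight k τ) (monoOf β)))) (upTo n)
  coeff-𝓑-even e = begin
    coeff (𝓑 N) e
      ≡⟨ coeff-𝓑 N e ⟩
    sumBy (λ σ → δ e (monoOf σ)) (dumont132 N)
      ≡⟨ sumBy-dumont132-even (λ σ → δ e (monoOf σ)) ⟩
    sumBy (λ β → δ e (monoOf (N ∷ β))) (dumont132 n) +ℤ sumBy (oddBlockSum n (λ k τ β → δ e (monoOf (glue k τ β)))) (upTo n)
      ≡⟨ cong₂ _+ℤ_ starts-with-N (sumBy-cong∈ (upTo n) (λ k k∈ → glued-k (∈-upTo⁻ k∈))) ⟩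
    coeff (𝓑 n) e +ℤ sumBy (oddBlockSum n (λ k τ β → δ e (mulMono (blockWeight k τ) (monoOf β)))) (upTo n) ∎
    where
    starts-with-N : sumBy (λ β → δ e (monoOf (N ∷ β))) (dumont132 n) ≡ coeff (𝓑 n) e
    starts-with-N = trans (sumBy-cong∈ (dumont132 n) (λ β β∈ → δ-congʳ e (monoOf (N ∷ β)) (monoOf β) (monoOf-N∷ β∈)))
                          (sym (coeff-𝓑 n e))
    glued-k : ∀ {k} → k < n → oddBlockSum n (λ k τ β → δ e (monoOf (glue k τ β))) k
                            ≡ oddBlockSum n (λ k τ β → δ e (mulMono (blockWeight k τ) (monoOf β))) k
    glued-k {k} k<n with even k in k-parity
    ... | true  = refl
    ... | false = sumBy-cong∈ (dumont132 (k ∸ 1)) λ τ τ∈ → sumBy-cong∈ (dumont132 (n ∸ k)) λ β β∈ →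
                    δ-congʳ e (monoOf (glue k τ β)) (mulMono (blockWeight k τ) (monoOf β)) (monoOf-glue k<n k-parity τ∈ β∈)

coeff-𝓑-odd : ∀ m → even (suc m) ≡ true → ∀ e →
  coeff (𝓑 (suc (suc m))) e ≡ sumBy (λ ρ → δ e (mulMono x₂ (σ₁Mono (monoOf ρ)))) (dumont132 (suc m))
coeff-𝓑-odd m sucm-even e = begin
  coeff (𝓑 (suc (suc m))) e
    ≡⟨ coeff-𝓑 (suc (suc m)) e ⟩
  sumBy (λ σ → δ e (monoOf σ)) (dumont132 (suc (suc m)))
    ≡⟨ sumBy-dumont132-odd (suc m) m-odd (λ σ → δ e (monoOf σ)) ⟩
  sumBy (λ ρ → δ e (monoOf (ρ ++ suc (suc m) ∷ []))) (dumont132 (suc m))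
    ≡⟨ sumBy-cong∈ (dumont132 (suc m)) append-max ⟩
  sumBy (λ ρ → δ e (mulMono x₂ (σ₁Mono (monoOf ρ)))) (dumont132 (suc m)) ∎
  where
  m-odd : even m ≡ false
  m-odd = even-pred-flip m sucm-even
  append-max : ∀ ρ → ρ ∈ dumont132 (suc m) → δ e (monoOf (ρ ++ suc (suc m) ∷ [])) ≡ δ e (mulMono x₂ (σ₁Mono (monoOf ρ)))
  append-max []      ρ∈ with dumont132-length (suc m) ρ∈
  ... | ()
  append-max (y ∷ r) ρ∈ = δ-congʳ e (monoOf ((y ∷ r) ++ suc (suc m) ∷ [])) (mulMono x₂ (σ₁Mono (monoOf (y ∷ r))))
    (monoOf-∷ʳ-max y r (suc (suc m)) (within-< (dumont132-within (suc m) ρ∈)))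

-- The functional equation

U : Series
U = constS oneP ⊕ (⊖ constS (var 2)) ⊕ (constS (var 2) ⊛ substS σ₁Mono A2)

H : Series
H = constS oneP ⊕ (⊖ constS (mulP (var 2) (var 3))) ⊕ (constS (mulP (var 2) (var 3)) ⊛ substS σ₂Mono A2)

x₁²x₂H : Series
x₁²x₂H = x₁²· (constS (var 2) ⊛ H)

numerator : Series
numerator = x₁²· U

denominator : Series
denominator = constS oneP ⊕ (⊖ x₁²x₂H)

A2⁺ : Series
A2⁺ zero    = []
A2⁺ (suc m) = A2 (suc m)

A2-even : ∀ m → even m ≡ true → A2 m ≡ 𝓑 m
A2-even m m-even = cong (λ b → if b then 𝓑 m else []) m-even

A2-odd : ∀ m → even m ≡ false → A2 m ≡ []
A2-odd m m-odd = cong (λ b → if b then 𝓑 m else []) m-odd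

linExt-unit : ∀ h a → linExt h ((1ℤ , a) ∷ []) ≡ h a
linExt-unit h a = trans (ℤP.+-identityʳ _) (ℤP.*-identityˡ (h a))

cancel-constant : ∀ h a b → (linExt h ((1ℤ , a) ∷ []) +ℤ - linExt h ((1ℤ , b) ∷ [])) +ℤ linExt h ((1ℤ , b) ∷ []) ≡ h a
cancel-constant h a b = begin
  (linExt h ((1ℤ , a) ∷ []) +ℤ - B) +ℤ B  ≡⟨ ℤP.+-assoc (linExt h ((1ℤ , a) ∷ [])) (- B) B ⟩
  linExt h ((1ℤ , a) ∷ []) +ℤ (- B +ℤ B)  ≡⟨ cong (linExt h ((1ℤ , a) ∷ []) +ℤ_) (ℤP.+-inverseˡ B) ⟩
  linExt h ((1ℤ , a) ∷ []) +ℤ 0ℤ          ≡⟨ ℤP.+-identityʳ _ ⟩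
  linExt h ((1ℤ , a) ∷ [])                ≡⟨ linExt-unit h a ⟩
  h a                                     ∎
  where
  B = linExt h ((1ℤ , b) ∷ [])

linExt-U : ∀ h m → linExt h (U m) ≡ (linExt h (constS oneP m) +ℤ - linExt h (constS (var 2) m))
                                     +ℤ linExt (λ a → h (mulMono x₂ (σ₁Mono a))) (A2 m)
linExt-U h m = begin
  linExt h (U m)
    ≡⟨ linExt-++ h (constS oneP m ++ negP (constS (var 2) m)) _ ⟩
  linExt h (constS oneP m ++ negP (constS (var 2) m)) +ℤ linExt h ((constS (var 2) ⊛ substS σ₁Mono A2) m)
    ≡⟨ cong₂ _+ℤ_ (trans (linExt-++ h (constS oneP m) _) (cong (linExt h (constS oneP m) +ℤ_) (linExt-negP h (constS (var 2) m))))
                  (linExt-constS-⊛ h (var 2) (substS σ₁Mono A2) m) ⟩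
  (linExt h (constS oneP m) +ℤ - linExt h (constS (var 2) m)) +ℤ linExt h (mulP (var 2) (substP σ₁Mono (A2 m)))
    ≡⟨ cong ((linExt h (constS oneP m) +ℤ - linExt h (constS (var 2) m)) +ℤ_)
            (trans (linExt-mulP-monomial h x₂ (substP σ₁Mono (A2 m))) (linExt-substP _ σ₁Mono (A2 m))) ⟩
  (linExt h (constS oneP m) +ℤ - linExt h (constS (var 2) m)) +ℤ linExt (λ a → h (mulMono x₂ (σ₁Mono a))) (A2 m) ∎

linExt-H : ∀ h m → linExt h (H m) ≡ (linExt h (constS oneP m) +ℤ - linExt h (constS (mulP (var 2) (var 3)) m))
                                     +ℤ linExt (λ a → h (mulMono x₂x₃ (σ₂Mono a))) (A2 m)
linExt-H h m = begin
  linExt h (H m)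
    ≡⟨ linExt-++ h (constS oneP m ++ negP (constS x₂x₃′ m)) _ ⟩
  linExt h (constS oneP m ++ negP (constS x₂x₃′ m)) +ℤ linExt h ((constS x₂x₃′ ⊛ substS σ₂Mono A2) m)
    ≡⟨ cong₂ _+ℤ_ (trans (linExt-++ h (constS oneP m) _) (cong (linExt h (constS oneP m) +ℤ_) (linExt-negP h (constS x₂x₃′ m))))
                  (linExt-constS-⊛ h x₂x₃′ (substS σ₂Mono A2) m) ⟩
  (linExt h (constS oneP m) +ℤ - linExt h (constS x₂x₃′ m)) +ℤ linExt h (mulP x₂x₃′ (substP σ₂Mono (A2 m)))
    ≡⟨ cong ((linExt h (constS oneP m) +ℤ - linExt h (constS x₂x₃′ m)) +ℤ_)
            (trans (linExt-mulP-monomial h x₂x₃ (substP σ₂Mono (A2 m))) (linExt-substP _ σ₂Mono (A2 m))) ⟩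
  (linExt h (constS oneP m) +ℤ - linExt h (constS x₂x₃′ m)) +ℤ linExt (λ a → h (mulMono x₂x₃ (σ₂Mono a))) (A2 m) ∎
  where
  x₂x₃′ = mulP (var 2) (var 3)

U-odd : ∀ m → even m ≡ false → ∀ e → coeff (U m) e ≡ 0ℤ
U-odd (suc m) m-odd e = begin
  coeff (U (suc m)) e                  ≡⟨ coeff≡linExt-δ (U (suc m)) e ⟩
  linExt (δ e) (U (suc m))             ≡⟨ linExt-U (δ e) (suc m) ⟩
  0ℤ +ℤ linExt δ-x₂σ₁ (A2 (suc m))     ≡⟨ cong (λ p → 0ℤ +ℤ linExt δ-x₂σ₁ p) (A2-odd (suc m) m-odd) ⟩
  0ℤ                                   ∎
  where
  δ-x₂σ₁ = λ a → δ e (mulMono x₂ (σ₁Mono a))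

U-even : ∀ m → even m ≡ true → ∀ e → coeff (U m) e ≡ coeff (𝓑 (suc m)) e
U-even zero    _      e = begin
  coeff (U 0) e                 ≡⟨ coeff≡linExt-δ (U 0) e ⟩
  linExt (δ e) (U 0)            ≡⟨ linExt-U (δ e) 0 ⟩
  _                             ≡⟨ cancel-constant (δ e) [] x₂ ⟩
  δ e []                        ≡⟨ δ-congʳ e [] (0 ∷ []) (λ { zero → refl ; (suc i) → refl }) ⟩
  δ e (0 ∷ [])                  ≡⟨ linExt-unit (δ e) (0 ∷ []) ⟨
  linExt (δ e) (𝓑 1)            ≡⟨ coeff≡linExt-δ (𝓑 1) e ⟨
  coeff (𝓑 1) e                 ∎
U-even (suc m) m-even e = begin
  coeff (U (suc m)) e                                              ≡⟨ coeff≡linExt-δ (U (suc m)) e ⟩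
  linExt (δ e) (U (suc m))                                         ≡⟨ linExt-U (δ e) (suc m) ⟩
  0ℤ +ℤ linExt δ-x₂σ₁ (A2 (suc m))                                 ≡⟨ ℤP.+-identityˡ _ ⟩
  linExt δ-x₂σ₁ (A2 (suc m))                                       ≡⟨ cong (linExt δ-x₂σ₁) (A2-even (suc m) m-even) ⟩
  linExt δ-x₂σ₁ (𝓑 (suc m))                                        ≡⟨ linExt-unitTerms δ-x₂σ₁ monoOf (dumont132 (suc m)) ⟩
  sumBy (λ ρ → δ e (mulMono x₂ (σ₁Mono (monoOf ρ)))) (dumont132 (suc m)) ≡⟨ coeff-𝓑-odd m m-even e ⟨
  coeff (𝓑 (suc (suc m))) e                                        ∎
  where
  δ-x₂σ₁ = λ a → δ e (mulMono x₂ (σ₁Mono a))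

linExt-x₁²x₂H : ∀ g j → linExt g (x₁²x₂H (suc (suc j))) ≡ linExt (λ a → g (mulMono x₂ a)) (H j)
linExt-x₁²x₂H g j = trans (linExt-constS-⊛ g (var 2) H j) (linExt-mulP-monomial g x₂ (H j))

linExt-x₁²x₂H-even : ∀ k → even k ≡ true → ∀ g → linExt g (x₁²x₂H (suc k)) ≡ 0ℤ
linExt-x₁²x₂H-even zero          _      g = refl
linExt-x₁²x₂H-even (suc (suc j)) k-even g = begin
  linExt g (x₁²x₂H (suc (suc (suc j))))                                   ≡⟨ linExt-x₁²x₂H g (suc j) ⟩
  linExt (λ a → g (mulMono x₂ a)) (H (suc j))                             ≡⟨ linExt-H (λ a → g (mulMono x₂ a)) (suc j) ⟩
  0ℤ +ℤ linExt (λ a → g (mulMono x₂ (mulMono x₂x₃ (σ₂Mono a)))) (A2 (suc j))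
    ≡⟨ cong (λ p → 0ℤ +ℤ linExt (λ a → g (mulMono x₂ (mulMono x₂x₃ (σ₂Mono a)))) p)
            (A2-odd (suc j) (even-suc-flip j k-even)) ⟩
  0ℤ                                                                      ∎

linExt-x₁²x₂H-odd : ∀ k → even k ≡ false → ∀ g →
                    linExt g (x₁²x₂H (suc k)) ≡ sumBy (λ τ → g (blockWeight k τ)) (dumont132 (k ∸ 1))
linExt-x₁²x₂H-odd (suc zero)          _     g = begin
  linExt g (x₁²x₂H 2)                                 ≡⟨ linExt-x₁²x₂H g 0 ⟩
  linExt (λ a → g (mulMono x₂ a)) (H 0)               ≡⟨ linExt-H (λ a → g (mulMono x₂ a)) 0 ⟩
  _                                                   ≡⟨ cancel-constant (λ a → g (mulMono x₂ a)) [] x₂x₃ ⟩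
  g x₂                                                ≡⟨ ℤP.+-identityʳ (g x₂) ⟨
  sumBy (λ τ → g (blockWeight 1 τ)) (dumont132 0)     ∎
linExt-x₁²x₂H-odd (suc (suc (suc j))) k-odd g = begin
  linExt g (x₁²x₂H (suc K))                                               ≡⟨ linExt-x₁²x₂H g (suc (suc j)) ⟩
  linExt (λ a → g (mulMono x₂ a)) (H (suc (suc j)))                       ≡⟨ linExt-H (λ a → g (mulMono x₂ a)) (suc (suc j)) ⟩
  0ℤ +ℤ linExt (λ a → g (mulMono x₂ (mulMono x₂x₃ (σ₂Mono a)))) (A2 (suc (suc j))) ≡⟨ ℤP.+-identityˡ _ ⟩
  linExt (λ a → g (mulMono x₂ (mulMono x₂x₃ (σ₂Mono a)))) (A2 (suc (suc j)))
    ≡⟨ cong (linExt (λ a → g (mulMono x₂ (mulMono x₂x₃ (σ₂Mono a)))))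
            (A2-even (suc (suc j)) (even-pred-flip (suc (suc j)) k-odd)) ⟩
  linExt (λ a → g (mulMono x₂ (mulMono x₂x₃ (σ₂Mono a)))) (𝓑 (suc (suc j)))
    ≡⟨ linExt-unitTerms _ monoOf (dumont132 (suc (suc j))) ⟩
  sumBy (λ τ → g (blockWeight K τ)) (dumont132 (suc (suc j)))             ∎
  where
  K = suc (suc (suc j))

coeff-mulP-negP : ∀ p q e → coeff (mulP (negP p) q) e ≡ - coeff (mulP p q) e
coeff-mulP-negP p q e = begin
  coeff (mulP (negP p) q) e                                      ≡⟨ coeff-mulP e (negP p) q ⟩
  linExt (λ a → linExt (λ b → δ e (mulMono a b)) q) (negP p)     ≡⟨ linExt-negP _ p ⟩
  - linExt (λ a → linExt (λ b → δ e (mulMono a b)) q) p          ≡⟨ cong -_ (coeff-mulP e p q) ⟨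
  - coeff (mulP p q) e                                           ∎

coeff-x₁²x₂H-A2-even-k : ∀ k r e → even k ≡ true → coeff (mulP (x₁²x₂H (suc k)) (A2 r)) e ≡ 0ℤ
coeff-x₁²x₂H-A2-even-k k r e k-even = trans (coeff-mulP e (x₁²x₂H (suc k)) (A2 r)) (linExt-x₁²x₂H-even k k-even _)

coeff-x₁²x₂H-A2-odd-r : ∀ k r e → even r ≡ false → coeff (mulP (x₁²x₂H (suc k)) (A2 r)) e ≡ 0ℤ
coeff-x₁²x₂H-A2-odd-r k r e r-odd =
  trans (coeff-mulP e (x₁²x₂H (suc k)) (A2 r))
        (linExt-zero (λ a → cong (linExt (λ b → δ e (mulMono a b))) (A2-odd r r-odd)) (x₁²x₂H (suc k)))

coeff-x₁²x₂H-A2-odd-k : ∀ k r e → even k ≡ false → even r ≡ true →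
  coeff (mulP (x₁²x₂H (suc k)) (A2 r)) e
    ≡ sumBy (λ τ → sumBy (λ β → δ e (mulMono (blockWeight k τ) (monoOf β))) (dumont132 r)) (dumont132 (k ∸ 1))
coeff-x₁²x₂H-A2-odd-k k r e k-odd r-even = begin
  coeff (mulP (x₁²x₂H (suc k)) (A2 r)) e
    ≡⟨ coeff-mulP e (x₁²x₂H (suc k)) (A2 r) ⟩
  linExt (λ a → linExt (λ b → δ e (mulMono a b)) (A2 r)) (x₁²x₂H (suc k))
    ≡⟨ linExt-x₁²x₂H-odd k k-odd _ ⟩
  sumBy (λ τ → linExt (λ b → δ e (mulMono (blockWeight k τ) b)) (A2 r)) (dumont132 (k ∸ 1))
    ≡⟨ sumBy-cong (λ τ → trans (cong (linExt (λ b → δ e (mulMono (blockWeight k τ) b))) (A2-even r r-even))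
                               (linExt-unitTerms _ monoOf (dumont132 r))) (dumont132 (k ∸ 1)) ⟩
  sumBy (λ τ → sumBy (λ β → δ e (mulMono (blockWeight k τ) (monoOf β))) (dumont132 r)) (dumont132 (k ∸ 1)) ∎

coeff-numerator-even : ∀ n → even n ≡ true → ∀ e → coeff (numerator (suc n)) e ≡ 0ℤ
coeff-numerator-even zero    _      e = refl
coeff-numerator-even (suc m) n-even e = U-odd m (even-pred-flip m n-even) e

coeff-numerator-odd : ∀ n → even n ≡ false → ∀ e → coeff (numerator (suc n)) e ≡ coeff (𝓑 n) e
coeff-numerator-odd (suc m) n-odd e = U-even m (even-pred-flip m n-odd) e

convolution-A2⁺ : ∀ n e →
  - sumBy (λ k → coeff (mulP (denominator (suc k)) (A2⁺ (n ∸ k))) e) (upTo (suc n))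
    ≡ sumBy (λ k → coeff (mulP (x₁²x₂H (suc k)) (A2 (n ∸ k))) e) (upTo n)
convolution-A2⁺ n e = begin
  - sumBy (λ k → coeff (mulP (negP (x₁²x₂H (suc k))) (A2⁺ (n ∸ k))) e) (upTo (suc n))
    ≡⟨ cong -_ (sumBy-cong (λ k → coeff-mulP-negP (x₁²x₂H (suc k)) (A2⁺ (n ∸ k)) e) (upTo (suc n))) ⟩
  - sumBy (λ k → - P k) (upTo (suc n))
    ≡⟨ cong -_ (sumBy-neg P (upTo (suc n))) ⟩
  - - sumBy P (upTo (suc n))
    ≡⟨ ℤP.neg-involutive _ ⟩
  sumBy P (upTo (suc n))
    ≡⟨ sumBy-upTo-suc n P ⟩
  sumBy P (upTo n) +ℤ P n
    ≡⟨ cong₂ _+ℤ_ (sumBy-cong∈ (upTo n) λ k k∈ → cong (λ p → coeff (mulP (x₁²x₂H (suc k)) p) e) (A2⁺-pos (∈-upTo⁻ k∈)))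
                  last-term ⟩
  sumBy (λ k → coeff (mulP (x₁²x₂H (suc k)) (A2 (n ∸ k))) e) (upTo n) +ℤ 0ℤ
    ≡⟨ ℤP.+-identityʳ _ ⟩
  sumBy (λ k → coeff (mulP (x₁²x₂H (suc k)) (A2 (n ∸ k))) e) (upTo n) ∎
  where
  P : ℕ → ℤ
  P k = coeff (mulP (x₁²x₂H (suc k)) (A2⁺ (n ∸ k))) e
  A2⁺-pos : ∀ {k} → k < n → A2⁺ (n ∸ k) ≡ A2 (n ∸ k)
  A2⁺-pos {k} k<n with n ∸ k | ℕP.m<n⇒0<n∸m k<n
  ... | suc _ | _ = refl
  last-term : P n ≡ 0ℤ
  last-term = trans (coeff-mulP e (x₁²x₂H (suc n)) (A2⁺ (n ∸ n)))
                    (linExt-zero (λ a → cong (λ m → linExt (λ b → δ e (mulMono a b)) (A2⁺ m)) (ℕP.n∸n≡0 n)) (x₁²x₂H (suc n)))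

A2⁺-recurrence : ∀ n e →
  coeff (A2⁺ (suc n)) e
    ≡ coeff (numerator (suc n)) e +ℤ - sumBy (λ k → coeff (mulP (denominator (suc k)) (A2⁺ (n ∸ k))) e) (upTo (suc n))
A2⁺-recurrence n e rewrite convolution-A2⁺ n e with even n in n-parity
... | true = begin
  coeff (A2 (suc n)) e  ≡⟨ cong (λ p → coeff p e) (A2-odd (suc n) (even-suc-flip n n-parity)) ⟩
  0ℤ                    ≡⟨ cong₂ _+ℤ_ (coeff-numerator-even n n-parity e)
                                      (trans (sumBy-cong∈ (upTo n) vanishing) (sumBy-zero (λ _ → refl) (upTo n))) ⟨
  coeff (numerator (suc n)) e +ℤ sumBy (λ k → coeff (mulP (x₁²x₂H (suc k)) (A2 (n ∸ k))) e) (upTo n) ∎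
  where
  vanishing : ∀ k → k ∈ upTo n → coeff (mulP (x₁²x₂H (suc k)) (A2 (n ∸ k))) e ≡ 0ℤ
  vanishing k k∈ with even k in k-parity
  ... | true  = coeff-x₁²x₂H-A2-even-k k (n ∸ k) e k-parity
  ... | false = coeff-x₁²x₂H-A2-odd-r k (n ∸ k) e (even∸odd-odd n k (ℕP.<⇒≤ (∈-upTo⁻ k∈)) n-parity k-parity)
... | false = begin
  coeff (A2 (suc n)) e   ≡⟨ cong (λ p → coeff p e) (A2-even (suc n) (even-suc-flip n n-parity)) ⟩
  coeff (𝓑 (suc n)) e    ≡⟨ EvenLength.coeff-𝓑-even n n-parity e ⟩
  coeff (𝓑 n) e +ℤ _     ≡⟨ cong₂ _+ℤ_ (sym (coeff-numerator-odd n n-parity e)) (sym (sumBy-cong∈ (upTo n) by-parity)) ⟩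
  coeff (numerator (suc n)) e +ℤ sumBy (λ k → coeff (mulP (x₁²x₂H (suc k)) (A2 (n ∸ k))) e) (upTo n) ∎
  where
  by-parity : ∀ k → k ∈ upTo n → coeff (mulP (x₁²x₂H (suc k)) (A2 (n ∸ k))) e
                                 ≡ oddBlockSum n (λ k τ β → δ e (mulMono (blockWeight k τ) (monoOf β))) k
  by-parity k k∈ with even k in k-parity
  ... | true  = coeff-x₁²x₂H-A2-even-k k (n ∸ k) e k-parity
  ... | false = coeff-x₁²x₂H-A2-odd-k k (n ∸ k) e k-parity (odd∸odd-even n k (ℕP.<⇒≤ (∈-upTo⁻ k∈)) n-parity k-parity)

B2-odd : ∀ m → even m ≡ false → B2 m ≡ 𝓑 m
B2-odd m m-odd = cong (λ b → if b then [] else 𝓑 m) m-odd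

B2-even : ∀ m → even m ≡ true → B2 m ≡ []
B2-even m m-even = cong (λ b → if b then [] else 𝓑 m) m-even

B2≈x₁U : B2 ≈S x₁¹· U
B2≈x₁U zero    e = refl
B2≈x₁U (suc m) e = by-parity (even m) refl
  where
  by-parity : ∀ b → even m ≡ b → coeff (B2 (suc m)) e ≡ coeff (U m) e
  by-parity true  m-even = trans (cong (λ p → coeff p e) (B2-odd (suc m) (even-suc-flip m m-even))) (sym (U-even m m-even e))
  by-parity false m-odd  = trans (cong (λ p → coeff p e) (B2-even (suc m) (even-suc-flip m m-odd))) (sym (U-odd m m-odd e))

A2≈1+quotient : A2 ≈S (constS oneP ⊕ (numerator ⊘ denominator))
A2≈1+quotient zero    e = refl
A2≈1+quotient (suc m) e = sym (⊘-unique numerator denominator A2⁺ (λ _ → refl) A2⁺-recurrence (suc m) e)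

theorem2p11 : (A2 ≈S (constS oneP ⊕
    (x₁²· (constS oneP ⊕ (⊖ constS (var 2)) ⊕ (constS (var 2) ⊛ substS σ₁Mono A2))
    ⊘ (constS oneP ⊕ (⊖ x₁²· (constS (var 2) ⊛
    (constS oneP ⊕ (⊖ constS (mulP (var 2) (var 3)))
    ⊕ (constS (mulP (var 2) (var 3)) ⊛ substS σ₂Mono A2))))))))
    × (B2 ≈S (x₁¹· (constS oneP ⊕ (⊖ constS (var 2)) ⊕ (constS (var 2) ⊛ substS σ₁Mono A2))))
theorem2p11 = A2≈1+quotient , B2≈x₁U
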